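{- Let $\mathfrak{s}=(s_1,\dots,s_r)\in\mathbb{N}^r$, $\mathbf{u}=(u_1,\dots,u_r)\in(\bar k^\times)^r$, and let $G=(\mathbb{G}_a^d,\rho)$ be the $t$-module described in the context, with logarithm $\log_G=\sum_{i\ge0}P_i\tau^i$, $P_0=I_d$. Write $P_i$ in blocks $P_i[\ell m]\in\mathrm{Mat}_{d_\ell\times d_m}(\bar k)$. Then $P_i[\ell m]=0$ for $\ell>m$. For $\ell\le m$, let $y_i[\ell m]$ denote the lower-right corner entry (row $d_\ell$, column $d_m$) of $P_i[\ell m]$. Then $y_i[\ell\ell]=\dfrac{1}{L_i^{d_\ell}}$, and for $\ell<m$, $y_i[\ell m]=(-1)^{m-\ell}\sum_{0\le i_\ell\le\cdots\le i_{m-1}<i}\dfrac{u_\ell^{q^{i_\ell}}\cdots u_{m-1}^{q^{i_{m-1}}}}{L_{i_\ell}^{s_\ell}\cdots L_{i_{m-1}}^{s_{m-1}}L_i^{d_m}}.$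
   Context: $A=\mathbb{F}_q[\theta]$, $k=\mathbb{F}_q(\theta)$, $\bar k$ an algebraic closure. $L_0=1$, $L_i=\prod_{j=1}^i(\theta-\theta^{q^j})$. $\tau$ is the $q$-th power Frobenius with $\tau\alpha=\alpha^q\tau$. For a $t$-module $G=(\mathbb{G}_a^d,\rho)$ ($\rho:\mathbb{F}_q[t]\to\mathrm{Mat}_d(\bar k[\tau])$ an $\mathbb{F}_q$-linear ring homomorphism with $\partial\rho_t-\theta I_d$ nilpotent, $\partial$ = constant term in $\tau$), the logarithm is the unique formal series $\log_G=\sum_{i\ge0}P_i\tau^i$, $P_0=I_d$, $P_i\in\mathrm{Mat}_d(\bar k)$, satisfying $\log_G\circ\rho_a=\partial\rho_a\circ\log_G$ for all $a\in\mathbb{F}_q[t]$. Construction of $G$: $d_\ell=s_\ell+\cdots+s_r$ for $1\le\ell\le r$, $d=d_1+\cdots+d_r$; $d\times d$ matrices are written in blocks, the $(\ell,m)$ block being $d_\ell\times d_m$. $N$ is block diagonal, its $\ell$-th diagonal block being the $d_\ell\times d_\ell$ matrix with $1$'s on the superdiagonal and $0$ elsewhere. $E$ has $(\ell,m)$ block zero for $\ell>m$, and for $\ell\le m$ the block is zero except its lower-left entry (row $d_\ell$, column $1$), which equals $1$ if $\ell=m$ and $(-1)^{m-\ell}u_\ell u_{\ell+1}\cdots u_{m-1}$ if $\ell<m$. Then $\rho_t=\theta I_d+N+E\tau$. -}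

module Defs where

open import Level using (Level; _⊔_) renaming (suc to lsuc)
open import Algebra.Bundles using (CommutativeRing)
open import Data.Nat as ℕ using (ℕ; zero; suc; _∸_; _<?_; _≟_; _≤?_; _≤ᵇ_)
open import Data.Fin using (Fin; toℕ; fromℕ<) renaming (zero to fz; suc to fs)
open import Data.Product using (Σ; _,_; ∃; _×_)
open import Data.Bool using (Bool; true; false; if_then_else_; _∧_)
open import Data.List using (List; []; _∷_; _++_; [_])
open import Data.List.Relation.Unary.All using (All)
open import Data.List.Relation.Unary.Any using (Any)
open import Relation.Nullary using (¬_; yes; no)
open import Relation.Nullary.Decidable using (⌊_⌋)
open import Data.Vec.Functional using () renaming (_∷_ to _∷ᶠ_)

record Field (c ℓ : Level) : Set (lsuc (c ⊔ ℓ)) where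
  field
    commRing : CommutativeRing c ℓ
  open CommutativeRing commRing public
  field
    _⁻¹ : Carrier → Carrier
    ⁻¹-inverse : ∀ x → ¬ (x ≈ 0#) → (x * (x ⁻¹)) ≈ 1#
    0≉1 : ¬ (0# ≈ 1#)

sumRangeℕ : ℕ → ℕ → (ℕ → ℕ) → ℕ
sumRangeℕ a b f = go (b ∸ a) a
  where
  go : ℕ → ℕ → ℕ
  go zero _ = 0
  go (suc n) j = f j ℕ.+ go n (suc j)

ext : ∀ {a} {A : Set a} {r : ℕ} → (Fin r → A) → A → ℕ → A
ext {r = r} f dflt j with j <? r
... | yes p = f (fromℕ< p)
... | no _ = dflt

-- d_ℓ = s_ℓ + ... + s_r  (0-based: ℓ ∈ {0..r-1}, d ℓ = Σ_{ℓ ≤ j < r} s j)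
dd : {r : ℕ} → (Fin r → ℕ) → ℕ → ℕ
dd {r} s ℓ = sumRangeℕ ℓ r (ext s 0)

-- block index: (block ℓ, position inside the block, 0-based)
Idx : {r : ℕ} → (Fin r → ℕ) → Set
Idx {r} s = Σ (Fin r) (λ ℓ → Fin (dd s (toℕ ℓ)))

nondec : {k n : ℕ} → (Fin k → Fin n) → Bool
nondec {zero} f = true
nondec {suc zero} f = true
nondec {suc (suc k)} f = (toℕ (f fz) ≤ᵇ toℕ (f (fs fz))) ∧ nondec {suc k} (λ j → f (fs j))

module FieldOps {c ℓ : Level} (F : Field c ℓ) where
  open Field F

  pow : Carrier → ℕ → Carrier
  pow x zero = 1#
  pow x (suc n) = x * pow x n

  ofℕ : ℕ → Carrier
  ofℕ zero = 0#
  ofℕ (suc n) = 1# + ofℕ n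

  ∑Fin : (n : ℕ) → (Fin n → Carrier) → Carrier
  ∑Fin zero g = 0#
  ∑Fin (suc n) g = g fz + ∑Fin n (λ j → g (fs j))

  ∏Fin : (n : ℕ) → (Fin n → Carrier) → Carrier
  ∏Fin zero g = 1#
  ∏Fin (suc n) g = g fz * ∏Fin n (λ j → g (fs j))

  ∑Fun : (k n : ℕ) → ((Fin k → Fin n) → Carrier) → Carrier
  ∑Fun zero n g = g (λ ())
  ∑Fun (suc k) n g = ∑Fin n (λ x → ∑Fun k n (λ f → g (x ∷ᶠ f)))

  ∏Range : ℕ → ℕ → (ℕ → Carrier) → Carrier
  ∏Range a b g = go (b ∸ a) a
    where
    go : ℕ → ℕ → Carrier
    go zero _ = 1#
    go (suc n) j = g j * go n (suc j)

  evalPoly : List Carrier → Carrier → Carrier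
  evalPoly [] x = 0#
  evalPoly (a ∷ as) x = a + x * evalPoly as x

  -- the ambient field  k̄ = algebraic closure of k = F_q(θ)

  InFq : ℕ → Carrier → Set ℓ
  InFq q x = pow x q ≈ x

  InA : ℕ → Carrier → Carrier → Set (c ⊔ ℓ)
  InA q θ x = ∃ λ (cs : List Carrier) → All (InFq q) cs × (x ≈ evalPoly cs θ)

  AlgClosed : Set (c ⊔ ℓ)
  AlgClosed = ∀ (c₀ : Carrier) (cs : List Carrier) (a : Carrier) → ¬ (a ≈ 0#) →
              ∃ λ x → evalPoly (c₀ ∷ cs ++ [ a ]) x ≈ 0#

  Transcendental : ℕ → Carrier → Set (c ⊔ ℓ)
  Transcendental q θ = ∀ (cs : List Carrier) → All (InFq q) cs →
                       evalPoly cs θ ≈ 0# → All (λ a → a ≈ 0#) cs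

  -- every element algebraic over k = F_q(θ) (equivalently over A)
  AlgebraicOverk : ℕ → Carrier → Set (c ⊔ ℓ)
  AlgebraicOverk q θ = ∀ x → ∃ λ (cs : List Carrier) →
      All (InA q θ) cs × Any (λ a → ¬ (a ≈ 0#)) cs × (evalPoly cs x ≈ 0#)

  Lfac : ℕ → Carrier → ℕ → Carrier
  Lfac q θ i = ∏Range 1 (suc i) (λ j → θ - pow θ (q ℕ.^ j))

  module Blocks {r : ℕ} (s : Fin r → ℕ) where

    Mat : Set c
    Mat = Idx s → Idx s → Carrier

    ∑Idx : (Idx s → Carrier) → Carrier
    ∑Idx g = ∑Fin r (λ l → ∑Fin (dd s (toℕ l)) (λ a → g (l , a)))

    _⋆_ : Mat → Mat → Mat
    (A ⋆ B) x y = ∑Idx (λ z → A x z * B z y)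

    _⊕_ : Mat → Mat → Mat
    (A ⊕ B) x y = A x y + B x y

    zeroM : Mat
    zeroM x y = 0#

    -- entrywise q^i-th power (the twist by τ^i)
    twist : ℕ → ℕ → Mat → Mat
    twist q i A x y = pow (A x y) (q ℕ.^ i)

    eqIdx : Idx s → Idx s → Bool
    eqIdx (l , a) (m , b) = ⌊ toℕ l ≟ toℕ m ⌋ ∧ ⌊ toℕ a ≟ toℕ b ⌋

    idM : Mat
    idM x y = if eqIdx x y then 1# else 0#

    scal : Carrier → Mat
    scal t x y = if eqIdx x y then t else 0#

    Nmat : Mat
    Nmat (l , a) (m , b) =
      if ⌊ toℕ l ≟ toℕ m ⌋ ∧ ⌊ suc (toℕ a) ≟ toℕ b ⌋ then 1# else 0#

    Ecoef : (Fin r → Carrier) → ℕ → ℕ → Carrier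
    Ecoef u l m = pow (- 1#) (m ∸ l) * ∏Range l m (ext u 1#)

    Emat : (Fin r → Carrier) → Mat
    Emat u (l , a) (m , b) =
      if ⌊ toℕ l ≤? toℕ m ⌋ ∧ ⌊ toℕ a ≟ dd s (toℕ l) ∸ 1 ⌋ ∧ ⌊ toℕ b ≟ 0 ⌋
      then Ecoef u (toℕ l) (toℕ m) else 0#

    -- ρ_t = ρ0 + ρ1 τ,  ρ0 = θ I + N = ∂ρ_t,  ρ1 = E
    ρ0 : Carrier → Mat
    ρ0 θ = scal θ ⊕ Nmat

    _≈M_ : Mat → Mat → Set ℓ
    A ≈M B = ∀ x y → A x y ≈ B x y

    -- coefficient of τ^i in  (Σ P_i τ^i) ∘ ρ_t  =  (∂ρ_t) ∘ (Σ P_i τ^i)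
    --   P_i (ρ0)^{(i)} + P_{i-1} (ρ1)^{(i-1)} = ρ0 P_i
    prevTerm : ℕ → (Fin r → Carrier) → (ℕ → Mat) → ℕ → Mat
    prevTerm q u P zero = zeroM
    prevTerm q u P (suc j) = P j ⋆ twist q j (Emat u)

    IsLogG : ℕ → Carrier → (Fin r → Carrier) → (ℕ → Mat) → Set ℓ
    IsLogG q θ u P =
      (P 0 ≈M idM) ×
      (∀ i → ((P i ⋆ twist q i (ρ0 θ)) ⊕ prevTerm q u P i) ≈M (ρ0 θ ⋆ P i))

    -- the sum  Σ_{0 ≤ i_ℓ ≤ ⋯ ≤ i_{m-1} < i}
    --   u_ℓ^{q^{i_ℓ}}⋯u_{m-1}^{q^{i_{m-1}}} / (L_{i_ℓ}^{s_ℓ}⋯L_{i_{m-1}}^{s_{m-1}} L_i^{d_m})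
    -- with the variables i_{ℓ+j} = f j  for j < m - ℓ.
    Ysum : ℕ → Carrier → (Fin r → Carrier) → ℕ → ℕ → ℕ → Carrier
    Ysum q θ u l m i = ∑Fun (m ∸ l) i (λ f →
      if nondec f
      then ∏Fin (m ∸ l) (λ j → pow (ext u 1# (l ℕ.+ toℕ j)) (q ℕ.^ toℕ (f j)))
           * ((∏Fin (m ∸ l) (λ j → pow (Lfac q θ (toℕ (f j))) (ext s 0 (l ℕ.+ toℕ j)))
               * pow (Lfac q θ i) (dd s m)) ⁻¹)
      else 0#)

module Submission where

-- The coefficients P_i of log_G are determined by P_0 = I and, for i ≥ 1, by
-- the τ^i-coefficient of  log_G ∘ ρ_t = ∂ρ_t ∘ log_G, which (with c_i =
-- θ - θ^{q^i} ≠ 0) reads entrywise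
--      c_i · P_i  =  P_i N − N P_i + P_{i-1} E^{(q^{i-1})}.
-- (1) Lower block-triangularity: by induction on i, and inside a fixed i by
--     induction on the distance of the row to the bottom of its block and of
--     the column to the left of its block, every term on the right vanishes.
-- (2) Last rows: in the last row of block ℓ the term N P_i vanishes, so
--     scanning the columns of block m from the left gives
--     c_i^{d_m} · y_i[ℓ m] = Σ_{ℓ ≤ n ≤ m} y_{i-1}[ℓ n] · (E_{n m})^{q^{i-1}}.
-- (3) The closed form of the theorem satisfies the same recursion.  Writing
--     the sum over non-decreasing sequences recursively (NondecSum), this is
--     the identity obtained by splitting off the trailing entries equal to
--     the largest admissible value (nondecSum-split).

open import Defs
open import Level using (Level)
open import Data.Nat.Primality using (Prime)
open import Data.Nat using (ℕ; _<_; _≤_; _∸_; _^_)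
open import Data.Fin using (Fin; toℕ)
open import Data.Product using (_×_; _,_)
open import Relation.Nullary using (¬_)
open import Relation.Binary.PropositionalEquality using (_≡_)

open import Data.Nat as ℕ using (zero; suc; z≤n; s≤s; _≤ᵇ_; _≟_; _≤?_)
  renaming (_+_ to _+ℕ_; _*_ to _*ℕ_)
import Data.Nat.Properties as NP
open import Data.Nat.Divisibility using (divides)
open import Data.Nat.Primality using (prime⇒nonTrivial; prime⇒irreducible)
open import Data.Nat.Tactic.RingSolver using (solve-∀)
open import Data.Fin using (fromℕ<) renaming (zero to fz; suc to fs)
import Data.Fin.Properties as FP
open import Data.Bool using (Bool; true; false; if_then_else_; _∧_)
open import Data.Empty using (⊥-elim)
open import Data.Sum using (_⊎_; inj₁; inj₂)
open import Data.Product using (Σ; proj₁; proj₂)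
open import Relation.Nullary using (yes; no)
open import Relation.Nullary.Decidable using (⌊_⌋)
import Relation.Binary.PropositionalEquality as Eq
open import Data.Vec.Functional using () renaming (_∷_ to _∷ᶠ_)
open import Data.List using (List; []; _∷_; replicate; _++_)
open import Data.List.Relation.Unary.All as All using (All)
import Data.List.Relation.Unary.All.Properties as AllP

∸-step : ∀ a b n → b ∸ a ≡ suc n → b ∸ suc a ≡ n
∸-step a b n e = Eq.trans (Eq.sym (NP.pred[m∸n]≡m∸[1+n] b a)) (Eq.cong ℕ.pred e)

∸-suc : ∀ {a b} → a < b → b ∸ a ≡ suc (b ∸ suc a)
∸-suc {zero} {suc b} _ = Eq.refl
∸-suc {suc a} {suc b} (s≤s a<b) = ∸-suc a<b

≤ᵇ-true : ∀ {m n} → m ≤ n → (m ≤ᵇ n) ≡ true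
≤ᵇ-true {m} {n} m≤n with m ≤ᵇ n | NP.≤⇒≤ᵇ m≤n
... | true | _ = Eq.refl

≤ᵇ-false : ∀ {m n} → n < m → (m ≤ᵇ n) ≡ false
≤ᵇ-false {m} {n} n<m with m ≤ᵇ n in eq
... | false = Eq.refl
... | true = ⊥-elim (NP.<⇒≱ n<m (NP.≤ᵇ⇒≤ m n (Eq.subst Data.Bool.T (Eq.sym eq) _)))

≟-true : ∀ {a b} → a ≡ b → ⌊ a ≟ b ⌋ ≡ true
≟-true {a} {b} e with a ≟ b
... | yes _ = Eq.refl
... | no ne = ⊥-elim (ne e)

≟-refl : ∀ a → ⌊ a ≟ a ⌋ ≡ true
≟-refl a = ≟-true Eq.refl

≟-false : ∀ {a b} → ¬ (a ≡ b) → ⌊ a ≟ b ⌋ ≡ false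
≟-false {a} {b} ne with a ≟ b
... | yes e = ⊥-elim (ne e)
... | no _ = Eq.refl

≟∧≟-true⇒ : ∀ a b c d → ⌊ a ≟ b ⌋ ∧ ⌊ c ≟ d ⌋ ≡ true → a ≡ b × c ≡ d
≟∧≟-true⇒ a b c d e with a ≟ b | c ≟ d
... | yes a≡b | yes c≡d = a≡b , c≡d
≟∧≟-true⇒ a b c d () | yes _ | no _
≟∧≟-true⇒ a b c d () | no _ | _

¬true⇒false : ∀ {b : Bool} → ¬ (b ≡ true) → b ≡ false
¬true⇒false {true} h = ⊥-elim (h Eq.refl)
¬true⇒false {false} h = Eq.refl

prime-power≥2 : ∀ {p e q} → Prime p → 1 ≤ e → q ≡ p ^ e → 2 ≤ q
prime-power≥2 {p} {e} p-prime e≥1 Eq.refl =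
  NP.≤-trans p≥2 (Eq.subst (_≤ p ^ e) (NP.*-identityʳ p) (NP.^-monoʳ-≤ p {{ℕ.nonTrivial⇒nonZero p {{prime⇒nonTrivial p-prime}}}} e≥1))
  where
  p≥2 : 2 ≤ p
  p≥2 = ℕ.nonTrivial⇒n>1 p {{prime⇒nonTrivial p-prime}}

Odd : ℕ → Set
Odd n = Σ ℕ (λ k → n ≡ suc (k +ℕ k))

even⊎odd : ∀ n → Σ ℕ (λ k → n ≡ k +ℕ k) ⊎ Odd n
even⊎odd zero = inj₁ (0 , Eq.refl)
even⊎odd (suc n) with even⊎odd n
... | inj₁ (k , e) = inj₂ (k , Eq.cong suc e)
... | inj₂ (k , e) = inj₁ (suc k , Eq.cong suc (Eq.trans e (Eq.sym (NP.+-suc k k))))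

odd-* : ∀ {a b} → Odd a → Odd b → Odd (a *ℕ b)
odd-* (x , Eq.refl) (y , Eq.refl) = (y +ℕ x *ℕ suc (y +ℕ y)) , product x y
  where
  product : ∀ x y → suc (x +ℕ x) *ℕ suc (y +ℕ y)
                    ≡ suc ((y +ℕ x *ℕ suc (y +ℕ y)) +ℕ (y +ℕ x *ℕ suc (y +ℕ y)))
  product = solve-∀

odd-^ : ∀ {a} → Odd a → ∀ j → Odd (a ^ j)
odd-^ oa zero = (0 , Eq.refl)
odd-^ oa (suc j) = odd-* oa (odd-^ oa j)

prime≢2⇒odd : ∀ {p} → Prime p → ¬ (p ≡ 2) → Odd p
prime≢2⇒odd {p} p-prime p≢2 with even⊎odd p
... | inj₂ o = o
... | inj₁ (k , p≡k+k) with prime⇒irreducible p-prime (divides k p≡k*2)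
  where
  p≡k*2 : p ≡ k *ℕ 2
  p≡k*2 = Eq.trans p≡k+k (Eq.trans (Eq.cong (k +ℕ_) (Eq.sym (NP.+-identityʳ k))) (NP.*-comm 2 k))
...   | inj₁ ()
...   | inj₂ 2≡p = ⊥-elim (p≢2 (Eq.sym 2≡p))

module Development {c ℓ' : Level} (K : Field c ℓ') where
  open Field K
  open FieldOps K
  open import Relation.Binary.Reasoning.Setoid setoid
  open import Algebra.Properties.Ring ring using (-‿distribˡ-*; -1*x≈-x; -‿involutive)
  open import Algebra.Solver.Ring.NaturalCoefficients.Default commutativeSemiring
    using (solve; _:+_; _:*_; _:=_; con)

  infix 4 _≉0
  _≉0 : Carrier → Set ℓ'
  x ≉0 = ¬ (x ≈ 0#)

  ⁻¹-inverseˡ : ∀ {x} → x ≉0 → x ⁻¹ * x ≈ 1#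
  ⁻¹-inverseˡ {x} x≉0 = trans (*-comm _ _) (⁻¹-inverse x x≉0)

  cancelˡ : ∀ {a x y} → a ≉0 → a * x ≈ a * y → x ≈ y
  cancelˡ {a} {x} {y} a≉0 e = begin
    x              ≈⟨ sym (*-identityˡ x) ⟩
    1# * x         ≈⟨ *-congʳ (sym (⁻¹-inverseˡ a≉0)) ⟩
    (a ⁻¹ * a) * x ≈⟨ *-assoc _ _ _ ⟩
    a ⁻¹ * (a * x) ≈⟨ *-congˡ e ⟩
    a ⁻¹ * (a * y) ≈⟨ sym (*-assoc _ _ _) ⟩
    (a ⁻¹ * a) * y ≈⟨ *-congʳ (⁻¹-inverseˡ a≉0) ⟩
    1# * y         ≈⟨ *-identityˡ y ⟩
    y              ∎

  1≉0 : 1# ≉0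
  1≉0 e = 0≉1 (sym e)

  *-≉0 : ∀ {x y} → x ≉0 → y ≉0 → x * y ≉0
  *-≉0 {x} x≉0 y≉0 e = y≉0 (cancelˡ x≉0 (trans e (sym (zeroʳ x))))

  ⁻¹-unique : ∀ {x y} → x ≉0 → x * y ≈ 1# → y ≈ x ⁻¹
  ⁻¹-unique x≉0 e = cancelˡ x≉0 (trans e (sym (⁻¹-inverse _ x≉0)))

  ⁻¹-cong : ∀ {x y} → x ≉0 → x ≈ y → x ⁻¹ ≈ y ⁻¹
  ⁻¹-cong {x} {y} x≉0 x≈y =
    ⁻¹-unique (λ y≈0 → x≉0 (trans x≈y y≈0)) (trans (*-congʳ (sym x≈y)) (⁻¹-inverse x x≉0))

  ⁻¹-distrib-* : ∀ {x y} → x ≉0 → y ≉0 → (x * y) ⁻¹ ≈ x ⁻¹ * y ⁻¹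
  ⁻¹-distrib-* {x} {y} x≉0 y≉0 = sym (⁻¹-unique (*-≉0 x≉0 y≉0) (begin
    (x * y) * (x ⁻¹ * y ⁻¹)   ≈⟨ solve 4 (λ a b c d → (a :* b) :* (c :* d) := (a :* c) :* (b :* d)) refl x y (x ⁻¹) (y ⁻¹) ⟩
    (x * x ⁻¹) * (y * y ⁻¹)   ≈⟨ *-cong (⁻¹-inverse x x≉0) (⁻¹-inverse y y≉0) ⟩
    1# * 1#                   ≈⟨ *-identityˡ 1# ⟩
    1#                        ∎))

  1⁻¹≈1 : 1# ⁻¹ ≈ 1#
  1⁻¹≈1 = sym (⁻¹-unique 1≉0 (*-identityˡ 1#))

  pow-cong : ∀ {x y} n → x ≈ y → pow x n ≈ pow y n
  pow-cong zero e = refl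
  pow-cong (suc n) e = *-cong e (pow-cong n e)

  pow-+ : ∀ x m n → pow x (m +ℕ n) ≈ pow x m * pow x n
  pow-+ x zero n = sym (*-identityˡ _)
  pow-+ x (suc m) n = trans (*-congˡ (pow-+ x m n)) (sym (*-assoc _ _ _))

  pow-distrib-* : ∀ x y n → pow (x * y) n ≈ pow x n * pow y n
  pow-distrib-* x y zero = sym (*-identityˡ 1#)
  pow-distrib-* x y (suc n) = trans (*-congˡ (pow-distrib-* x y n))
    (solve 4 (λ a b c d → (a :* b) :* (c :* d) := (a :* c) :* (b :* d)) refl x y (pow x n) (pow y n))

  pow-pow : ∀ x m n → pow (pow x m) n ≈ pow x (m *ℕ n)
  pow-pow x m zero = reflexive (Eq.cong (pow x) (Eq.sym (NP.*-zeroʳ m)))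
  pow-pow x m (suc n) = begin
    pow x m * pow (pow x m) n   ≈⟨ *-congˡ (pow-pow x m n) ⟩
    pow x m * pow x (m *ℕ n)    ≈⟨ sym (pow-+ x m (m *ℕ n)) ⟩
    pow x (m +ℕ m *ℕ n)         ≡⟨ Eq.cong (pow x) (Eq.sym (NP.*-suc m n)) ⟩
    pow x (m *ℕ suc n)          ∎

  pow-comm : ∀ x m n → pow (pow x m) n ≈ pow (pow x n) m
  pow-comm x m n = trans (pow-pow x m n) (trans (reflexive (Eq.cong (pow x) (NP.*-comm m n))) (sym (pow-pow x n m)))

  pow-1# : ∀ n → pow 1# n ≈ 1#
  pow-1# zero = refl
  pow-1# (suc n) = trans (*-identityˡ _) (pow-1# n)

  pow-≉0 : ∀ {x} n → x ≉0 → pow x n ≉0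
  pow-≉0 zero x≉0 = 1≉0
  pow-≉0 (suc n) x≉0 = *-≉0 x≉0 (pow-≉0 n x≉0)

  pow-−1-odd : ∀ {n} → Odd n → pow (- 1#) n ≈ - 1#
  pow-−1-odd (k , Eq.refl) = begin
    - 1# * pow (- 1#) (k +ℕ k)          ≈⟨ *-congˡ (pow-+ (- 1#) k k) ⟩
    - 1# * (pow (- 1#) k * pow (- 1#) k) ≈⟨ *-congˡ (sym (pow-distrib-* (- 1#) (- 1#) k)) ⟩
    - 1# * pow (- 1# * - 1#) k          ≈⟨ *-congˡ (pow-cong k (trans (-1*x≈-x (- 1#)) (-‿involutive 1#))) ⟩
    - 1# * pow 1# k                     ≈⟨ *-congˡ (pow-1# k) ⟩
    - 1# * 1#                           ≈⟨ *-identityʳ _ ⟩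
    - 1#                                ∎

  if-true : ∀ {b : Bool} {x : Carrier} → b ≡ true → (if b then x else 0#) ≈ x
  if-true Eq.refl = refl

  if-false : ∀ {b : Bool} {x : Carrier} → b ≡ false → (if b then x else 0#) ≈ 0#
  if-false Eq.refl = refl

  if-*ˡ : ∀ (b : Bool) x y → (if b then x * y else 0#) ≈ x * (if b then y else 0#)
  if-*ˡ true x y = refl
  if-*ˡ false x y = sym (zeroʳ x)

  -- Solving the coefficient equation  X·c + R + E = θ·X + Z  (with Z = 0) for (θ − c)·X.
  isolate : ∀ {X c R E Z} θ → (X * c + R) + E ≈ θ * X + Z → Z ≈ 0# → (θ - c) * X ≈ R + E
  isolate {X} {c} {R} {E} {Z} θ eq Z≈0 = begin
    (θ + - c) * X                      ≈⟨ distribʳ X θ (- c) ⟩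
    θ * X + (- c) * X                  ≈⟨ +-cong θX (sym (-‿distribˡ-* c X)) ⟩
    (X * c + (R + E)) + - (c * X)      ≈⟨ +-congˡ (-‿cong (*-comm c X)) ⟩
    (X * c + (R + E)) + - (X * c)      ≈⟨ +-congʳ (+-comm _ _) ⟩
    ((R + E) + X * c) + - (X * c)      ≈⟨ +-assoc _ _ _ ⟩
    (R + E) + (X * c + - (X * c))      ≈⟨ +-congˡ (-‿inverseʳ _) ⟩
    (R + E) + 0#                       ≈⟨ +-identityʳ _ ⟩
    R + E                              ∎
    where
    θX : θ * X ≈ X * c + (R + E)
    θX = begin
      θ * X            ≈⟨ sym (+-identityʳ _) ⟩
      θ * X + 0#       ≈⟨ +-congˡ (sym Z≈0) ⟩
      θ * X + Z        ≈⟨ sym eq ⟩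
      (X * c + R) + E  ≈⟨ +-assoc _ _ _ ⟩
      X * c + (R + E)  ∎

  vanishes-by : ∀ {d X R E} → d ≉0 → d * X ≈ R + E → R ≈ 0# → E ≈ 0# → X ≈ 0#
  vanishes-by d≉0 e R≈0 E≈0 = cancelˡ d≉0 (trans e (trans (+-cong R≈0 E≈0) (trans (+-identityʳ 0#) (sym (zeroʳ _)))))

  -- Σ_{x < n} h x, built by adding the last term; this is the form in which
  -- the recursive description of sums over non-decreasing sequences is written.
  sumℕ : ℕ → (ℕ → Carrier) → Carrier
  sumℕ zero h = 0#
  sumℕ (suc n) h = sumℕ n h + h n

  sumℕ-cong : ∀ n {f g : ℕ → Carrier} → (∀ x → x < n → f x ≈ g x) → sumℕ n f ≈ sumℕ n g
  sumℕ-cong zero f≈g = refl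
  sumℕ-cong (suc n) f≈g = +-cong (sumℕ-cong n (λ x x<n → f≈g x (NP.m<n⇒m<1+n x<n))) (f≈g n (NP.n<1+n n))

  sumℕ-zero : ∀ n {f : ℕ → Carrier} → (∀ x → x < n → f x ≈ 0#) → sumℕ n f ≈ 0#
  sumℕ-zero zero f≈0 = refl
  sumℕ-zero (suc n) f≈0 = trans (+-cong (sumℕ-zero n (λ x x<n → f≈0 x (NP.m<n⇒m<1+n x<n))) (f≈0 n (NP.n<1+n n))) (+-identityˡ 0#)

  sumℕ-first : ∀ n (h : ℕ → Carrier) → sumℕ (suc n) h ≈ h 0 + sumℕ n (λ x → h (suc x))
  sumℕ-first zero h = trans (+-identityˡ _) (sym (+-identityʳ _))
  sumℕ-first (suc n) h = trans (+-congʳ (sumℕ-first n h)) (+-assoc _ _ _)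

  sumℕ-+ : ∀ n (f g : ℕ → Carrier) → sumℕ n (λ x → f x + g x) ≈ sumℕ n f + sumℕ n g
  sumℕ-+ zero f g = sym (+-identityˡ 0#)
  sumℕ-+ (suc n) f g = trans (+-congʳ (sumℕ-+ n f g))
    (solve 4 (λ a b c d → (a :+ b) :+ (c :+ d) := (a :+ c) :+ (b :+ d)) refl (sumℕ n f) (sumℕ n g) (f n) (g n))

  sumℕ-*ˡ : ∀ n a (f : ℕ → Carrier) → a * sumℕ n f ≈ sumℕ n (λ x → a * f x)
  sumℕ-*ˡ zero a f = zeroʳ a
  sumℕ-*ˡ (suc n) a f = trans (distribˡ a _ _) (+-congʳ (sumℕ-*ˡ n a f))

  sumℕ-*ʳ : ∀ n a (f : ℕ → Carrier) → sumℕ n f * a ≈ sumℕ n (λ x → f x * a)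
  sumℕ-*ʳ zero a f = zeroˡ a
  sumℕ-*ʳ (suc n) a f = trans (distribʳ a _ _) (+-congʳ (sumℕ-*ʳ n a f))

  sumℕ-swap : ∀ m n (f : ℕ → ℕ → Carrier) →
    sumℕ m (λ x → sumℕ n (λ y → f x y)) ≈ sumℕ n (λ y → sumℕ m (λ x → f x y))
  sumℕ-swap zero n f = sym (sumℕ-zero n (λ _ _ → refl))
  sumℕ-swap (suc m) n f = trans (+-congʳ (sumℕ-swap m n f)) (sym (sumℕ-+ n _ _))

  sumℕ-truncate : ∀ n N (f : ℕ → Carrier) → n ≤ N → (∀ x → n ≤ x → x < N → f x ≈ 0#) → sumℕ N f ≈ sumℕ n f
  sumℕ-truncate n zero f z≤n _ = refl
  sumℕ-truncate n (suc N) f n≤1+N f≈0 with n ≟ suc N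
  ... | yes Eq.refl = refl
  ... | no n≢1+N = trans (+-cong (sumℕ-truncate n N f n≤N (λ x n≤x x<N → f≈0 x n≤x (NP.m<n⇒m<1+n x<N)))
                                  (f≈0 N n≤N (NP.n<1+n N)))
                         (+-identityʳ _)
    where n≤N = NP.<⇒≤pred (NP.≤∧≢⇒< n≤1+N n≢1+N)

  sumℕ-from : ∀ l K (F : ℕ → Carrier) →
    sumℕ (l +ℕ K) (λ x → if l ≤ᵇ x then F x else 0#) ≈ sumℕ K (λ t → F (l +ℕ t))
  sumℕ-from l zero F = trans (reflexive (Eq.cong (λ n → sumℕ n F≥l) (NP.+-identityʳ l)))
    (sumℕ-zero l (λ x x<l → if-false (≤ᵇ-false x<l)))
    where
    F≥l : ℕ → Carrier
    F≥l x = if l ≤ᵇ x then F x else 0#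
  sumℕ-from l (suc K) F = trans (reflexive (Eq.cong (λ n → sumℕ n F≥l) (NP.+-suc l K)))
    (+-cong (sumℕ-from l K F) (if-true (≤ᵇ-true (NP.m≤m+n l K))))
    where
    F≥l : ℕ → Carrier
    F≥l x = if l ≤ᵇ x then F x else 0#

  ∑Fin-cong : ∀ n {f g : Fin n → Carrier} → (∀ x → f x ≈ g x) → ∑Fin n f ≈ ∑Fin n g
  ∑Fin-cong zero f≈g = refl
  ∑Fin-cong (suc n) f≈g = +-cong (f≈g fz) (∑Fin-cong n (λ x → f≈g (fs x)))

  ∑Fin-zero : ∀ n {f : Fin n → Carrier} → (∀ x → f x ≈ 0#) → ∑Fin n f ≈ 0#
  ∑Fin-zero zero f≈0 = refl
  ∑Fin-zero (suc n) f≈0 = trans (+-cong (f≈0 fz) (∑Fin-zero n (λ x → f≈0 (fs x)))) (+-identityˡ 0#)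

  ∑Fin-+ : ∀ n (f g : Fin n → Carrier) → ∑Fin n (λ x → f x + g x) ≈ ∑Fin n f + ∑Fin n g
  ∑Fin-+ zero f g = sym (+-identityˡ 0#)
  ∑Fin-+ (suc n) f g = trans (+-congˡ (∑Fin-+ n _ _))
    (solve 4 (λ a b c d → (a :+ b) :+ (c :+ d) := (a :+ c) :+ (b :+ d)) refl (f fz) (g fz) _ _)

  ∑Fin-*ʳ : ∀ n a (f : Fin n → Carrier) → ∑Fin n f * a ≈ ∑Fin n (λ x → f x * a)
  ∑Fin-*ʳ zero a f = zeroˡ a
  ∑Fin-*ʳ (suc n) a f = trans (distribʳ a _ _) (+-congˡ (∑Fin-*ʳ n a _))

  ∑Fin-δ : ∀ n (x₀ : Fin n) {f : Fin n → Carrier} → (∀ x → ¬ (toℕ x ≡ toℕ x₀) → f x ≈ 0#) → ∑Fin n f ≈ f x₀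
  ∑Fin-δ (suc n) fz f≈0 = trans (+-congˡ (∑Fin-zero n (λ x → f≈0 (fs x) (λ ())))) (+-identityʳ _)
  ∑Fin-δ (suc n) (fs x₀) f≈0 =
    trans (+-cong (f≈0 fz (λ ())) (∑Fin-δ n x₀ (λ x x≢x₀ → f≈0 (fs x) (λ e → x≢x₀ (NP.suc-injective e)))))
          (+-identityˡ _)

  ∑Fin-toℕ : ∀ n (h : ℕ → Carrier) → ∑Fin n (λ x → h (toℕ x)) ≈ sumℕ n h
  ∑Fin-toℕ zero h = refl
  ∑Fin-toℕ (suc n) h = trans (+-congˡ (∑Fin-toℕ n (λ x → h (suc x)))) (sym (sumℕ-first n h))

  sum-between : ∀ r l M (F : ℕ → Carrier) → l ≤ M → M < r →
    ∑Fin r (λ n → if toℕ n ≤ᵇ M then (if l ≤ᵇ toℕ n then F (toℕ n) else 0#) else 0#)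
      ≈ sumℕ (suc (M ∸ l)) (λ t → F (l +ℕ t))
  sum-between r l M F l≤M M<r = begin
    ∑Fin r (λ n → G (toℕ n))   ≈⟨ ∑Fin-toℕ r G ⟩
    sumℕ r G                    ≈⟨ sumℕ-truncate (suc M) r G M<r (λ k M<k _ → if-false (≤ᵇ-false M<k)) ⟩
    sumℕ (suc M) G              ≈⟨ sumℕ-cong (suc M) (λ k k≤M → if-true (≤ᵇ-true (NP.<⇒≤pred k≤M))) ⟩
    sumℕ (suc M) F≥l            ≡⟨ Eq.cong (λ n → sumℕ n F≥l) 1+M ⟩
    sumℕ (l +ℕ suc (M ∸ l)) F≥l ≈⟨ sumℕ-from l (suc (M ∸ l)) F ⟩
    sumℕ (suc (M ∸ l)) (λ t → F (l +ℕ t)) ∎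
    where
    F≥l G : ℕ → Carrier
    F≥l k = if l ≤ᵇ k then F k else 0#
    G k = if k ≤ᵇ M then F≥l k else 0#
    1+M : suc M ≡ l +ℕ suc (M ∸ l)
    1+M = Eq.trans (Eq.cong suc (Eq.sym (NP.m+[n∸m]≡n l≤M))) (Eq.sym (NP.+-suc l (M ∸ l)))

  ∑Fun-cong : ∀ k n {g g' : (Fin k → Fin n) → Carrier} → (∀ f → g f ≈ g' f) → ∑Fun k n g ≈ ∑Fun k n g'
  ∑Fun-cong zero n g≈g' = g≈g' _
  ∑Fun-cong (suc k) n g≈g' = ∑Fin-cong n (λ x → ∑Fun-cong k n (λ f → g≈g' (x ∷ᶠ f)))

  ∑Fun-zero : ∀ k n {g : (Fin k → Fin n) → Carrier} → (∀ f → g f ≈ 0#) → ∑Fun k n g ≈ 0#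
  ∑Fun-zero zero n g≈0 = g≈0 _
  ∑Fun-zero (suc k) n g≈0 = ∑Fin-zero n (λ x → ∑Fun-zero k n (λ f → g≈0 (x ∷ᶠ f)))

  ∑Fun-*ʳ : ∀ k n a (g : (Fin k → Fin n) → Carrier) → ∑Fun k n g * a ≈ ∑Fun k n (λ f → g f * a)
  ∑Fun-*ʳ zero n a g = refl
  ∑Fun-*ʳ (suc k) n a g = trans (∑Fin-*ʳ n a _) (∑Fin-cong n (λ x → ∑Fun-*ʳ k n a _))

  ∑Fun-*ˡ : ∀ k n a (g : (Fin k → Fin n) → Carrier) → ∑Fun k n (λ f → a * g f) ≈ a * ∑Fun k n g
  ∑Fun-*ˡ k n a g = trans (∑Fun-cong k n (λ f → *-comm _ _)) (trans (sym (∑Fun-*ʳ k n a g)) (*-comm _ _))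

  ∏Fin-* : ∀ n (f g : Fin n → Carrier) → ∏Fin n (λ x → f x * g x) ≈ ∏Fin n f * ∏Fin n g
  ∏Fin-* zero f g = sym (*-identityˡ 1#)
  ∏Fin-* (suc n) f g = trans (*-congˡ (∏Fin-* n _ _))
    (solve 4 (λ a b c d → (a :* b) :* (c :* d) := (a :* c) :* (b :* d)) refl (f fz) (g fz) _ _)

  ∏Fin-≉0 : ∀ n (f : Fin n → Carrier) → (∀ x → f x ≉0) → ∏Fin n f ≉0
  ∏Fin-≉0 zero f f≉0 = 1≉0
  ∏Fin-≉0 (suc n) f f≉0 = *-≉0 (f≉0 fz) (∏Fin-≉0 n _ (λ x → f≉0 (fs x)))

  ∏Fin-⁻¹ : ∀ n (f : Fin n → Carrier) → (∀ x → f x ≉0) → (∏Fin n f) ⁻¹ ≈ ∏Fin n (λ x → f x ⁻¹)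
  ∏Fin-⁻¹ zero f f≉0 = 1⁻¹≈1
  ∏Fin-⁻¹ (suc n) f f≉0 =
    trans (⁻¹-distrib-* (f≉0 fz) (∏Fin-≉0 n _ (λ x → f≉0 (fs x)))) (*-congˡ (∏Fin-⁻¹ n _ (λ x → f≉0 (fs x))))

  ∏From : ℕ → ℕ → (ℕ → Carrier) → Carrier
  ∏From zero a g = 1#
  ∏From (suc n) a g = g a * ∏From n (suc a) g

  sumFrom : ℕ → ℕ → (ℕ → ℕ) → ℕ
  sumFrom zero a f = 0
  sumFrom (suc n) a f = f a +ℕ sumFrom n (suc a) f

  ∏Range-nil : ∀ a b g → b ∸ a ≡ 0 → ∏Range a b g ≡ 1#
  ∏Range-nil a b g e with b ∸ a
  ∏Range-nil a b g Eq.refl | .0 = Eq.refl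

  ∏Range-cons : ∀ a b g n → b ∸ a ≡ suc n → ∏Range a b g ≡ g a * ∏Range (suc a) b g
  ∏Range-cons a b g n e = step e (∸-step a b n e)
    where
    step : b ∸ a ≡ suc n → b ∸ suc a ≡ n → ∏Range a b g ≡ g a * ∏Range (suc a) b g
    step e₁ e₂ with b ∸ a | b ∸ suc a
    step Eq.refl Eq.refl | .(suc n) | .n = Eq.refl

  ∏Range-count : ∀ a b g → ∏Range a b g ≡ ∏From (b ∸ a) a g
  ∏Range-count a b g = count (b ∸ a) a Eq.refl
    where
    count : ∀ n a → b ∸ a ≡ n → ∏Range a b g ≡ ∏From n a g
    count zero a e = ∏Range-nil a b g e
    count (suc n) a e = Eq.trans (∏Range-cons a b g n e) (Eq.cong (g a *_) (count n (suc a) (∸-step a b n e)))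

  sumRange-count : ∀ a b f → sumRangeℕ a b f ≡ sumFrom (b ∸ a) a f
  sumRange-count a b f = count (b ∸ a) a Eq.refl
    where
    nil : ∀ a → b ∸ a ≡ 0 → sumRangeℕ a b f ≡ 0
    nil a e with b ∸ a
    nil a Eq.refl | .0 = Eq.refl
    cons : ∀ a n → b ∸ a ≡ suc n → b ∸ suc a ≡ n → sumRangeℕ a b f ≡ f a +ℕ sumRangeℕ (suc a) b f
    cons a n e₁ e₂ with b ∸ a | b ∸ suc a
    cons a n Eq.refl Eq.refl | .(suc n) | .n = Eq.refl
    count : ∀ n a → b ∸ a ≡ n → sumRangeℕ a b f ≡ sumFrom n a f
    count zero a e = nil a e
    count (suc n) a e = Eq.trans (cons a n e (∸-step a b n e)) (Eq.cong (f a +ℕ_) (count n (suc a) (∸-step a b n e)))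

  ∏From-snoc : ∀ n a g → ∏From (suc n) a g ≈ ∏From n a g * g (a +ℕ n)
  ∏From-snoc zero a g = trans (*-comm _ _) (*-congˡ (reflexive (Eq.cong g (Eq.sym (NP.+-identityʳ a)))))
  ∏From-snoc (suc n) a g = begin
    g a * ∏From (suc n) (suc a) g         ≈⟨ *-congˡ (∏From-snoc n (suc a) g) ⟩
    g a * (∏From n (suc a) g * g (suc a +ℕ n)) ≈⟨ sym (*-assoc _ _ _) ⟩
    ∏From (suc n) a g * g (suc a +ℕ n)   ≡⟨ Eq.cong (λ z → ∏From (suc n) a g * g z) (Eq.sym (NP.+-suc a n)) ⟩
    ∏From (suc n) a g * g (a +ℕ suc n)   ∎

  ∏From-* : ∀ n a f g → ∏From n a (λ j → f j * g j) ≈ ∏From n a f * ∏From n a g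
  ∏From-* zero a f g = sym (*-identityˡ 1#)
  ∏From-* (suc n) a f g = trans (*-congˡ (∏From-* n (suc a) f g))
    (solve 4 (λ a b c d → (a :* b) :* (c :* d) := (a :* c) :* (b :* d)) refl (f a) (g a) _ _)

  ∏From-pow : ∀ n a g Q → pow (∏From n a g) Q ≈ ∏From n a (λ j → pow (g j) Q)
  ∏From-pow zero a g Q = pow-1# Q
  ∏From-pow (suc n) a g Q = trans (pow-distrib-* _ _ Q) (*-congˡ (∏From-pow n (suc a) g Q))

  ∏From-≉0 : ∀ n a g → (∀ j → a ≤ j → g j ≉0) → ∏From n a g ≉0
  ∏From-≉0 zero a g g≉0 = 1≉0
  ∏From-≉0 (suc n) a g g≉0 = *-≉0 (g≉0 a NP.≤-refl) (∏From-≉0 n (suc a) g (λ j a<j → g≉0 j (NP.<⇒≤ a<j)))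

  ∏From-⁻¹ : ∀ n a g → (∀ j → g j ≉0) → (∏From n a g) ⁻¹ ≈ ∏From n a (λ j → g j ⁻¹)
  ∏From-⁻¹ zero a g g≉0 = 1⁻¹≈1
  ∏From-⁻¹ (suc n) a g g≉0 =
    trans (⁻¹-distrib-* (g≉0 a) (∏From-≉0 n (suc a) g (λ j _ → g≉0 j))) (*-congˡ (∏From-⁻¹ n (suc a) g g≉0))

  sumFrom-+ : ∀ n m a f → sumFrom (n +ℕ m) a f ≡ sumFrom n a f +ℕ sumFrom m (a +ℕ n) f
  sumFrom-+ zero m a f = Eq.cong (λ z → sumFrom m z f) (Eq.sym (NP.+-identityʳ a))
  sumFrom-+ (suc n) m a f = Eq.trans (Eq.cong (f a +ℕ_) (sumFrom-+ n m (suc a) f))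
    (Eq.trans (Eq.sym (NP.+-assoc (f a) _ _)) (Eq.cong (λ z → sumFrom (suc n) a f +ℕ sumFrom m z f) (Eq.sym (NP.+-suc a n))))

  pow-sumFrom : ∀ x n a f → pow x (sumFrom n a f) ≈ ∏From n a (λ j → pow x (f j))
  pow-sumFrom x zero a f = refl
  pow-sumFrom x (suc n) a f = trans (pow-+ x (f a) _) (*-congˡ (pow-sumFrom x n (suc a) f))

  ∏From-shift : ∀ n l a g → ∏From n (l +ℕ a) g ≡ ∏From n a (λ w → g (l +ℕ w))
  ∏From-shift zero l a g = Eq.refl
  ∏From-shift (suc n) l a g = Eq.cong (g (l +ℕ a) *_)
    (Eq.trans (Eq.cong (λ z → ∏From n z g) (Eq.sym (NP.+-suc l a))) (∏From-shift n l (suc a) g))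

  ∏Range-shift : ∀ l a b g → ∏Range (l +ℕ a) (l +ℕ b) g ≡ ∏Range a b (λ w → g (l +ℕ w))
  ∏Range-shift l a b g = Eq.trans (∏Range-count (l +ℕ a) (l +ℕ b) g)
    (Eq.trans (Eq.cong (λ n → ∏From n (l +ℕ a) g) (NP.[m+n]∸[m+o]≡n∸o l b a))
    (Eq.trans (∏From-shift (b ∸ a) l a g) (Eq.sym (∏Range-count a b _))))

  -- NondecSum A k i lo  =  Σ_{lo ≤ x₀ ≤ x₁ ≤ ⋯ ≤ x_{k−1} < i}  A 0 x₀ · A 1 x₁ ⋯ A (k−1) x_{k−1},
  -- the value x at position w being weighted by A w x.
  NondecSum : (ℕ → ℕ → Carrier) → ℕ → ℕ → ℕ → Carrier
  NondecSum A zero i lo = 1#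
  NondecSum A (suc k) i lo =
    sumℕ i (λ x → if lo ≤ᵇ x then A 0 x * NondecSum (λ w → A (suc w)) k i x else 0#)

  -- With values in [i, i+1) the only sequence is the constant one.
  nondecSum-constant : ∀ A k i → NondecSum A k (suc i) i ≈ ∏From k 0 (λ w → A w i)
  nondecSum-constant A zero i = refl
  nondecSum-constant A (suc k) i = begin
    sumℕ i T + T i                                      ≈⟨ +-congʳ (sumℕ-zero i below) ⟩
    0# + T i                                            ≈⟨ +-identityˡ _ ⟩
    T i                                                 ≈⟨ if-true (≤ᵇ-true (NP.≤-refl {i})) ⟩
    A 0 i * NondecSum (λ w → A (suc w)) k (suc i) i     ≈⟨ *-congˡ (nondecSum-constant (λ w → A (suc w)) k i) ⟩
    A 0 i * ∏From k 0 (λ w → A (suc w) i)               ≡⟨ Eq.cong (A 0 i *_) (Eq.sym (∏From-shift k 1 0 (λ w → A w i))) ⟩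
    ∏From (suc k) 0 (λ w → A w i)                       ∎
    where
    T : ℕ → Carrier
    T x = if i ≤ᵇ x then A 0 x * NondecSum (λ w → A (suc w)) k (suc i) x else 0#
    below : ∀ x → x < i → T x ≈ 0#
    below x x<i = if-false (≤ᵇ-false x<i)

  -- Enlarging the bound from i to i+1: split a sequence by the number k − j of
  -- its trailing entries equal to i; these contribute ∏_{j ≤ w < k} A w i.
  nondecSum-split : ∀ A k i lo → lo ≤ i →
    NondecSum A k (suc i) lo ≈ sumℕ (suc k) (λ j → NondecSum A j i lo * ∏Range j k (λ w → A w i))
  nondecSum-split A zero i lo lo≤i = begin
    1#                                        ≈⟨ sym (*-identityˡ 1#) ⟩
    1# * 1#                                   ≈⟨ sym (+-identityˡ _) ⟩
    0# + 1# * ∏Range 0 0 (λ w → A w i)        ∎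
  nondecSum-split A (suc k) i lo lo≤i = begin
    sumℕ i T + T i                      ≈⟨ +-cong smaller largest ⟩
    sumℕ (suc k) (λ j → F (suc j)) + F 0 ≈⟨ +-comm _ _ ⟩
    F 0 + sumℕ (suc k) (λ j → F (suc j)) ≈⟨ sym (sumℕ-first (suc k) F) ⟩
    sumℕ (suc (suc k)) F                ∎
    where
    A⁺ : ℕ → ℕ → Carrier
    A⁺ w = A (suc w)
    g : ℕ → Carrier
    g w = A w i
    T : ℕ → Carrier
    T x = if lo ≤ᵇ x then A 0 x * NondecSum A⁺ k (suc i) x else 0#
    F : ℕ → Carrier
    F j = NondecSum A j i lo * ∏Range j (suc k) g
    C : ℕ → ℕ → Carrier
    C x j = if lo ≤ᵇ x then A 0 x * NondecSum A⁺ j i x else 0#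
    Π⁺ : ℕ → Carrier
    Π⁺ j = ∏Range j k (λ w → g (suc w))
    -- first entry x < i: split the remaining sequence (induction hypothesis)
    term : ∀ x → x < i → T x ≈ sumℕ (suc k) (λ j → C x j * Π⁺ j)
    term x x<i with lo ≤ᵇ x
    ... | false = sym (sumℕ-zero (suc k) (λ _ _ → zeroˡ _))
    ... | true = begin
      A 0 x * NondecSum A⁺ k (suc i) x                              ≈⟨ *-congˡ (nondecSum-split A⁺ k i x (NP.<⇒≤ x<i)) ⟩
      A 0 x * sumℕ (suc k) (λ j → NondecSum A⁺ j i x * Π⁺ j)        ≈⟨ sumℕ-*ˡ (suc k) _ _ ⟩
      sumℕ (suc k) (λ j → A 0 x * (NondecSum A⁺ j i x * Π⁺ j))      ≈⟨ sumℕ-cong (suc k) (λ j _ → sym (*-assoc _ _ _)) ⟩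
      sumℕ (suc k) (λ j → (A 0 x * NondecSum A⁺ j i x) * Π⁺ j)      ∎
    smaller : sumℕ i T ≈ sumℕ (suc k) (λ j → F (suc j))
    smaller = begin
      sumℕ i T                                                ≈⟨ sumℕ-cong i term ⟩
      sumℕ i (λ x → sumℕ (suc k) (λ j → C x j * Π⁺ j))        ≈⟨ sumℕ-swap i (suc k) _ ⟩
      sumℕ (suc k) (λ j → sumℕ i (λ x → C x j * Π⁺ j))        ≈⟨ sumℕ-cong (suc k) (λ j _ → sym (sumℕ-*ʳ i (Π⁺ j) (λ x → C x j))) ⟩
      sumℕ (suc k) (λ j → NondecSum A (suc j) i lo * Π⁺ j)    ≈⟨ sumℕ-cong (suc k) (λ j _ → *-congˡ (reflexive (Eq.sym (∏Range-shift 1 j k g)))) ⟩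
      sumℕ (suc k) (λ j → F (suc j))                          ∎
    -- first entry x = i: the sequence is constant
    largest : T i ≈ F 0
    largest = begin
      T i                                          ≈⟨ if-true (≤ᵇ-true lo≤i) ⟩
      A 0 i * NondecSum A⁺ k (suc i) i             ≈⟨ *-congˡ (nondecSum-constant A⁺ k i) ⟩
      A 0 i * ∏From k 0 (λ w → g (suc w))          ≡⟨ Eq.cong (A 0 i *_) (Eq.sym (∏From-shift k 1 0 g)) ⟩
      ∏From (suc k) 0 g                            ≡⟨ Eq.sym (∏Range-count 0 (suc k) g) ⟩
      ∏Range 0 (suc k) g                           ≈⟨ sym (*-identityˡ _) ⟩
      F 0                                          ∎

  nondecFrom : ∀ {i} k → ℕ → (Fin k → Fin i) → Bool
  nondecFrom zero lo f = true
  nondecFrom (suc k) lo f = (lo ≤ᵇ toℕ (f fz)) ∧ nondec f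

  nondec-∷ : ∀ {i} k (x : Fin i) (f : Fin k → Fin i) → nondec {suc k} (x ∷ᶠ f) ≡ nondecFrom k (toℕ x) f
  nondec-∷ zero x f = Eq.refl
  nondec-∷ (suc k) x f = Eq.refl

  nondecSum-∑Fun : ∀ A k i lo →
    ∑Fun k i (λ f → if nondecFrom k lo f then ∏Fin k (λ j → A (toℕ j) (toℕ (f j))) else 0#) ≈ NondecSum A k i lo
  nondecSum-∑Fun A zero i lo = refl
  nondecSum-∑Fun A (suc k) i lo =
    trans (∑Fin-cong i first) (∑Fin-toℕ i (λ x → if lo ≤ᵇ x then A 0 x * NondecSum A⁺ k i x else 0#))
    where
    A⁺ : ℕ → ℕ → Carrier
    A⁺ w = A (suc w)
    Π⁺ : (Fin k → Fin i) → Carrier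
    Π⁺ f = ∏Fin k (λ j → A⁺ (toℕ j) (toℕ (f j)))
    first : ∀ x → ∑Fun k i (λ f → if (lo ≤ᵇ toℕ x) ∧ nondec (x ∷ᶠ f) then A 0 (toℕ x) * Π⁺ f else 0#)
                  ≈ (if lo ≤ᵇ toℕ x then A 0 (toℕ x) * NondecSum A⁺ k i (toℕ x) else 0#)
    first x with lo ≤ᵇ toℕ x
    ... | false = ∑Fun-zero k i (λ f → refl)
    ... | true = begin
      ∑Fun k i (λ f → if nondec (x ∷ᶠ f) then A 0 (toℕ x) * Π⁺ f else 0#)
        ≈⟨ ∑Fun-cong k i (λ f → reflexive (Eq.cong (λ b → if b then A 0 (toℕ x) * Π⁺ f else 0#) (nondec-∷ k x f))) ⟩
      ∑Fun k i (λ f → if nondecFrom k (toℕ x) f then A 0 (toℕ x) * Π⁺ f else 0#)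
        ≈⟨ ∑Fun-cong k i (λ f → if-*ˡ (nondecFrom k (toℕ x) f) _ _) ⟩
      ∑Fun k i (λ f → A 0 (toℕ x) * (if nondecFrom k (toℕ x) f then Π⁺ f else 0#))
        ≈⟨ ∑Fun-*ˡ k i _ _ ⟩
      A 0 (toℕ x) * ∑Fun k i (λ f → if nondecFrom k (toℕ x) f then Π⁺ f else 0#)
        ≈⟨ *-congˡ (nondecSum-∑Fun A⁺ k i (toℕ x)) ⟩
      A 0 (toℕ x) * NondecSum A⁺ k i (toℕ x) ∎

  -- In characteristic p, (−1)^(q^j) = −1 for every power q of p: for p = 2
  -- because −1 = 1, otherwise because q^j is odd.
  −1^q^j≈−1 : ∀ {p e q} → Prime p → q ≡ p ^ e → ofℕ p ≈ 0# → ∀ j → pow (- 1#) (q ^ j) ≈ - 1#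
  −1^q^j≈−1 {p} {e} {q} p-prime q≡p^e char-p j with p ≟ 2
  ... | yes Eq.refl = trans (pow-cong (q ^ j) −1≈1) (trans (pow-1# (q ^ j)) (sym −1≈1))
    where
    −1≈1 : - 1# ≈ 1#
    −1≈1 = begin
      - 1#                ≈⟨ sym (+-identityʳ _) ⟩
      - 1# + 0#           ≈⟨ +-congˡ (sym (trans (+-congˡ (sym (+-identityʳ 1#))) char-p)) ⟩
      - 1# + (1# + 1#)    ≈⟨ sym (+-assoc _ _ _) ⟩
      (- 1# + 1#) + 1#    ≈⟨ +-congʳ (-‿inverseˡ 1#) ⟩
      0# + 1#             ≈⟨ +-identityˡ 1# ⟩
      1#                  ∎
  ... | no p≢2 = pow-−1-odd (odd-^ (Eq.subst Odd (Eq.sym q≡p^e) (odd-^ (prime≢2⇒odd p-prime p≢2) e)) j)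

  evalPoly-monomial : ∀ n x a → evalPoly (replicate n 0# ++ (a ∷ [])) x ≈ pow x n * a
  evalPoly-monomial zero x a = trans (+-congˡ (zeroʳ x)) (trans (+-identityʳ a) (sym (*-identityˡ a)))
  evalPoly-monomial (suc n) x a =
    trans (+-identityˡ _) (trans (*-congˡ (evalPoly-monomial n x a)) (sym (*-assoc _ _ _)))

  module Constants (q : ℕ) (θ : Carrier) (q≥2 : 2 ≤ q) (−1^q^j : ∀ j → pow (- 1#) (q ^ j) ≈ - 1#)
                   (transcendental : Transcendental q θ) where

    q^j≥1 : ∀ j → 1 ≤ q ^ j
    q^j≥1 zero = NP.≤-refl
    q^j≥1 (suc j) = NP.*-mono-≤ (NP.≤-trans (s≤s z≤n) q≥2) (q^j≥1 j)

    0^q^j≈0 : ∀ j → pow 0# (q ^ j) ≈ 0#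
    0^q^j≈0 j with q ^ j | q^j≥1 j
    ... | suc n | _ = zeroˡ _

    cθ : ℕ → Carrier
    cθ j = θ - pow θ (q ^ j)

    -- c_j ≠ 0 for j ≥ 1: otherwise θ is a root of X − X^{q^j} ∈ F_q[X].
    cθ≉0 : ∀ j → 1 ≤ j → cθ j ≉0
    cθ≉0 j@(suc j-1) _ cθ≈0 = 1≉0 (coefficient-of-X (transcendental coefficients in-Fq root))
      where
      Q-2 : ℕ
      Q-2 = q ^ j ∸ 2
      Q≡2+Q-2 : q ^ j ≡ 2 +ℕ Q-2
      Q≡2+Q-2 = Eq.sym (NP.m+[n∸m]≡n (NP.*-mono-≤ q≥2 (q^j≥1 j-1)))
      coefficients : List Carrier
      coefficients = 0# ∷ 1# ∷ (replicate Q-2 0# ++ (- 1# ∷ []))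
      0∈Fq : InFq q 0#
      0∈Fq = Eq.subst (λ z → pow 0# z ≈ 0#) (NP.*-identityʳ q) (0^q^j≈0 1)
      −1∈Fq : InFq q (- 1#)
      −1∈Fq = Eq.subst (λ z → pow (- 1#) z ≈ - 1#) (NP.*-identityʳ q) (−1^q^j 1)
      in-Fq : All (InFq q) coefficients
      in-Fq = 0∈Fq All.∷ pow-1# q All.∷ AllP.++⁺ (AllP.replicate⁺ Q-2 0∈Fq) (−1∈Fq All.∷ All.[])
      root : evalPoly coefficients θ ≈ 0#
      root = begin
        0# + θ * (1# + θ * evalPoly (replicate Q-2 0# ++ (- 1# ∷ [])) θ)   ≈⟨ +-identityˡ _ ⟩
        θ * (1# + θ * evalPoly (replicate Q-2 0# ++ (- 1# ∷ [])) θ)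
          ≈⟨ *-congˡ (+-congˡ (*-congˡ (evalPoly-monomial Q-2 θ (- 1#)))) ⟩
        θ * (1# + θ * (pow θ Q-2 * - 1#))
          ≈⟨ solve 3 (λ a b c → a :* (con 1 :+ a :* (b :* c)) := a :+ (a :* (a :* b)) :* c) refl θ (pow θ Q-2) (- 1#) ⟩
        θ + pow θ (2 +ℕ Q-2) * - 1#                                        ≡⟨ Eq.cong (λ z → θ + pow θ z * - 1#) (Eq.sym Q≡2+Q-2) ⟩
        θ + pow θ (q ^ j) * - 1#                                           ≈⟨ +-congˡ (trans (*-comm _ _) (-1*x≈-x _)) ⟩
        cθ j                                                               ≈⟨ cθ≈0 ⟩
        0#                                                                 ∎
      coefficient-of-X : All (λ a → a ≈ 0#) coefficients → 1# ≈ 0#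
      coefficient-of-X (_ All.∷ 1≈0 All.∷ _) = 1≈0

    L≉0 : ∀ i → Lfac q θ i ≉0
    L≉0 i = Eq.subst _≉0 (Eq.sym (∏Range-count 1 (suc i) cθ)) (∏From-≉0 i 1 cθ cθ≉0)

    L-suc : ∀ i → Lfac q θ (suc i) ≈ Lfac q θ i * cθ (suc i)
    L-suc i = begin
      Lfac q θ (suc i)           ≡⟨ ∏Range-count 1 (suc (suc i)) cθ ⟩
      ∏From (suc i) 1 cθ         ≈⟨ ∏From-snoc i 1 cθ ⟩
      ∏From i 1 cθ * cθ (suc i)  ≡⟨ Eq.cong (_* cθ (suc i)) (Eq.sym (∏Range-count 1 (suc i) cθ)) ⟩
      Lfac q θ i * cθ (suc i)    ∎

  module Matrices (q : ℕ) (θ : Carrier) (q≥2 : 2 ≤ q) (−1^q^j : ∀ j → pow (- 1#) (q ^ j) ≈ - 1#)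
                  (transcendental : Transcendental q θ) (r : ℕ) (s : Fin r → ℕ) (s≥1 : ∀ l → 1 ≤ s l)
                  (u : Fin r → Carrier) where
    open Constants q θ q≥2 −1^q^j transcendental
    open Blocks s

    -- d_n = s_n + d_{n+1} ≥ 1.
    d≥1 : ∀ (n : Fin r) → 1 ≤ dd s (toℕ n)
    d≥1 n = Eq.subst (1 ≤_) (Eq.sym d-first) (NP.≤-trans (Eq.subst (1 ≤_) (Eq.sym ext-toℕ) (s≥1 n)) (NP.m≤m+n _ _))
      where
      ext-toℕ : ext s 0 (toℕ n) ≡ s n
      ext-toℕ with toℕ n ℕ.<? r
      ... | yes n<r = Eq.cong s (FP.fromℕ<-toℕ n n<r)
      ... | no n≮r = ⊥-elim (n≮r (FP.toℕ<n n))
      d-first : dd s (toℕ n) ≡ ext s 0 (toℕ n) +ℕ sumFrom (r ∸ suc (toℕ n)) (suc (toℕ n)) (ext s 0)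
      d-first = Eq.trans (sumRange-count (toℕ n) r (ext s 0)) (Eq.cong (λ k → sumFrom k (toℕ n) (ext s 0)) (∸-suc (FP.toℕ<n n)))

    last : ∀ (n : Fin r) → Fin (dd s (toℕ n))
    last n = fromℕ< (NP.∸-monoˡ-< {m = dd s (toℕ n)} (NP.n<1+n _) (d≥1 n))

    toℕ-last : ∀ n → toℕ (last n) ≡ dd s (toℕ n) ∸ 1
    toℕ-last n = FP.toℕ-fromℕ< _

    suc-toℕ-last : ∀ n → suc (toℕ (last n)) ≡ dd s (toℕ n)
    suc-toℕ-last n = Eq.trans (Eq.cong suc (toℕ-last n)) (NP.m+[n∸m]≡n (d≥1 n))

    toℕ≡d-1⇒last : ∀ (n : Fin r) (a : Fin (dd s (toℕ n))) → toℕ a ≡ dd s (toℕ n) ∸ 1 → a ≡ last n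
    toℕ≡d-1⇒last n a e = FP.toℕ-injective (Eq.trans e (Eq.sym (toℕ-last n)))

    ∑Idx-cong : {g g' : Idx s → Carrier} → (∀ l a → g (l , a) ≈ g' (l , a)) → ∑Idx g ≈ ∑Idx g'
    ∑Idx-cong g≈g' = ∑Fin-cong r (λ l → ∑Fin-cong (dd s (toℕ l)) (λ a → g≈g' l a))

    ∑Idx-zero : {g : Idx s → Carrier} → (∀ l a → g (l , a) ≈ 0#) → ∑Idx g ≈ 0#
    ∑Idx-zero g≈0 = ∑Fin-zero r (λ l → ∑Fin-zero (dd s (toℕ l)) (λ a → g≈0 l a))

    ∑Idx-+ : (g g' : Idx s → Carrier) → ∑Idx (λ z → g z + g' z) ≈ ∑Idx g + ∑Idx g'
    ∑Idx-+ g g' = trans (∑Fin-cong r (λ l → ∑Fin-+ (dd s (toℕ l)) (λ a → g (l , a)) (λ a → g' (l , a)))) (∑Fin-+ r _ _)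

    ∑Idx-δ : (l₀ : Fin r) (a₀ : Fin (dd s (toℕ l₀))) {g : Idx s → Carrier} →
      (∀ l a → ¬ (toℕ l ≡ toℕ l₀ × toℕ a ≡ toℕ a₀) → g (l , a) ≈ 0#) → ∑Idx g ≈ g (l₀ , a₀)
    ∑Idx-δ l₀ a₀ g≈0 =
      trans (∑Fin-δ r l₀ (λ l l≢l₀ → ∑Fin-zero (dd s (toℕ l)) (λ a → g≈0 l a (λ e → l≢l₀ (proj₁ e)))))
            (∑Fin-δ (dd s (toℕ l₀)) a₀ (λ a a≢a₀ → g≈0 l₀ a (λ e → a≢a₀ (proj₂ e))))

    ⋆scal : ∀ t (X : Idx s → Carrier) y → ∑Idx (λ z → X z * scal t z y) ≈ X y * t
    ⋆scal t X (m , b) = trans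
      (∑Idx-δ m b (λ n c ne → trans (*-congˡ (if-false (¬true⇒false (λ e → ne (≟∧≟-true⇒ (toℕ n) (toℕ m) (toℕ c) (toℕ b) e))))) (zeroʳ _)))
      (*-congˡ (if-true (Eq.cong₂ _∧_ (≟-refl (toℕ m)) (≟-refl (toℕ b)))))

    scal⋆ : ∀ t (X : Idx s → Carrier) x → ∑Idx (λ z → scal t x z * X z) ≈ t * X x
    scal⋆ t X (l , a) = trans
      (∑Idx-δ l a (λ n c ne → trans (*-congʳ (if-false (¬true⇒false (λ e →
          let (l≡n , a≡c) = ≟∧≟-true⇒ (toℕ l) (toℕ n) (toℕ a) (toℕ c) e in ne (Eq.sym l≡n , Eq.sym a≡c))))) (zeroˡ _)))
      (*-congʳ (if-true (Eq.cong₂ _∧_ (≟-refl (toℕ l)) (≟-refl (toℕ a)))))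

    -- The entries of the twist (θI + N)^{(q^i)}: θ is raised to θ^{q^i}, N is unchanged.
    twist-ρ0 : ∀ (n m c b : ℕ) Q → 1 ≤ Q →
      pow ((if ⌊ n ≟ m ⌋ ∧ ⌊ c ≟ b ⌋ then θ else 0#) + (if ⌊ n ≟ m ⌋ ∧ ⌊ suc c ≟ b ⌋ then 1# else 0#)) Q
      ≈ (if ⌊ n ≟ m ⌋ ∧ ⌊ c ≟ b ⌋ then pow θ Q else 0#) + (if ⌊ n ≟ m ⌋ ∧ ⌊ suc c ≟ b ⌋ then 1# else 0#)
    twist-ρ0 n m c b (suc Q) _ with n ≟ m | c ≟ b | suc c ≟ b
    ... | yes _ | yes Eq.refl | yes e = ⊥-elim (NP.1+n≢n e)
    ... | yes _ | yes _ | no _ = trans (pow-cong (suc Q) (+-identityʳ θ)) (sym (+-identityʳ _))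
    ... | yes _ | no _ | yes _ = trans (pow-cong (suc Q) (+-identityˡ 1#)) (trans (pow-1# (suc Q)) (sym (+-identityˡ 1#)))
    ... | yes _ | no _ | no _ = trans (pow-cong (suc Q) (+-identityʳ 0#)) (trans (zeroˡ _) (sym (+-identityʳ 0#)))
    ... | no _ | _ | _ = trans (pow-cong (suc Q) (+-identityʳ 0#)) (trans (zeroˡ _) (sym (+-identityʳ 0#)))

    ⋆twist-ρ0 : ∀ (X : Mat) i x y → (X ⋆ twist q i (ρ0 θ)) x y ≈ X x y * pow θ (q ^ i) + ∑Idx (λ z → X x z * Nmat z y)
    ⋆twist-ρ0 X i x (m , b) = begin
      ∑Idx (λ z → X x z * twist q i (ρ0 θ) z (m , b))
        ≈⟨ ∑Idx-cong (λ n c → *-congˡ (twist-ρ0 (toℕ n) (toℕ m) (toℕ c) (toℕ b) (q ^ i) (q^j≥1 i))) ⟩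
      ∑Idx (λ z → X x z * (scal (pow θ (q ^ i)) z (m , b) + Nmat z (m , b)))
        ≈⟨ ∑Idx-cong (λ n c → distribˡ _ _ _) ⟩
      ∑Idx (λ z → X x z * scal (pow θ (q ^ i)) z (m , b) + X x z * Nmat z (m , b))
        ≈⟨ ∑Idx-+ _ _ ⟩
      ∑Idx (λ z → X x z * scal (pow θ (q ^ i)) z (m , b)) + ∑Idx (λ z → X x z * Nmat z (m , b))
        ≈⟨ +-congʳ (⋆scal _ (X x) (m , b)) ⟩
      X x (m , b) * pow θ (q ^ i) + ∑Idx (λ z → X x z * Nmat z (m , b)) ∎

    ρ0⋆ : ∀ (X : Mat) x y → (ρ0 θ ⋆ X) x y ≈ θ * X x y + ∑Idx (λ z → Nmat x z * X z y)
    ρ0⋆ X x y = begin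
      ∑Idx (λ z → (scal θ x z + Nmat x z) * X z y)                   ≈⟨ ∑Idx-cong (λ n c → distribʳ _ _ _) ⟩
      ∑Idx (λ z → scal θ x z * X z y + Nmat x z * X z y)             ≈⟨ ∑Idx-+ _ _ ⟩
      ∑Idx (λ z → scal θ x z * X z y) + ∑Idx (λ z → Nmat x z * X z y) ≈⟨ +-congʳ (scal⋆ θ (λ z → X z y) x) ⟩
      θ * X x y + ∑Idx (λ z → Nmat x z * X z y)                      ∎

    ⋆N-first-column : ∀ (X : Mat) x (m : Fin r) b → toℕ b ≡ 0 → ∑Idx (λ z → X x z * Nmat z (m , b)) ≈ 0#
    ⋆N-first-column X x m b b≡0 = ∑Idx-zero (λ n c → trans (*-congˡ (if-false (¬true⇒false (λ e →
      NP.1+n≢0 (Eq.trans (proj₂ (≟∧≟-true⇒ (toℕ n) (toℕ m) (suc (toℕ c)) (toℕ b) e)) b≡0))))) (zeroʳ _))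

    ⋆N-shift : ∀ (X : Mat) x (m : Fin r) b (c₀ : Fin (dd s (toℕ m))) → toℕ b ≡ suc (toℕ c₀) →
      ∑Idx (λ z → X x z * Nmat z (m , b)) ≈ X x (m , c₀)
    ⋆N-shift X x m b c₀ b≡1+c₀ = trans
      (∑Idx-δ m c₀ (λ n c ne → trans (*-congˡ (if-false (¬true⇒false (λ e →
        let (n≡m , 1+c≡b) = ≟∧≟-true⇒ (toℕ n) (toℕ m) (suc (toℕ c)) (toℕ b) e
        in ne (n≡m , NP.suc-injective (Eq.trans 1+c≡b b≡1+c₀)))))) (zeroʳ _)))
      (trans (*-congˡ (if-true (Eq.cong₂ _∧_ (≟-refl (toℕ m)) (≟-true (Eq.sym b≡1+c₀))))) (*-identityʳ _))

    N⋆-last-row : ∀ (X : Mat) (l : Fin r) a y → suc (toℕ a) ≡ dd s (toℕ l) → ∑Idx (λ z → Nmat (l , a) z * X z y) ≈ 0#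
    N⋆-last-row X l a y a-last = ∑Idx-zero (λ n c → trans (*-congʳ (if-false (¬true⇒false (λ e →
      let (l≡n , 1+a≡c) = ≟∧≟-true⇒ (toℕ l) (toℕ n) (suc (toℕ a)) (toℕ c) e
      in NP.<-irrefl (Eq.trans (Eq.sym 1+a≡c) (Eq.trans a-last (Eq.cong (dd s) l≡n))) (FP.toℕ<n c))))) (zeroˡ _))

    N⋆-shift : ∀ (X : Mat) (l : Fin r) a y (c₀ : Fin (dd s (toℕ l))) → toℕ c₀ ≡ suc (toℕ a) →
      ∑Idx (λ z → Nmat (l , a) z * X z y) ≈ X (l , c₀) y
    N⋆-shift X l a y c₀ c₀≡1+a = trans
      (∑Idx-δ l c₀ (λ n c ne → trans (*-congʳ (if-false (¬true⇒false (λ e →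
        let (l≡n , 1+a≡c) = ≟∧≟-true⇒ (toℕ l) (toℕ n) (suc (toℕ a)) (toℕ c) e
        in ne (Eq.sym l≡n , Eq.trans (Eq.sym 1+a≡c) (Eq.sym c₀≡1+a)))))) (zeroˡ _)))
      (trans (*-congʳ (if-true (Eq.cong₂ _∧_ (≟-refl (toℕ l)) (≟-true (Eq.sym c₀≡1+a))))) (*-identityˡ _))

    -- Right multiplication by the twist E^{(q^j)}: E has nonzero entries only in
    -- the first column of a block m, in the rows (n, last n) with n ≤ m.
    ⋆twist-E-lower : ∀ (X : Mat) j x (m : Fin r) b → (∀ (n : Fin r) c → toℕ n ≤ toℕ m → X x (n , c) ≈ 0#) →
      (X ⋆ twist q j (Emat u)) x (m , b) ≈ 0#
    ⋆twist-E-lower X j x m b X≈0 = ∑Idx-zero term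
      where
      term : ∀ n c → X x (n , c) * pow (Emat u (n , c) (m , b)) (q ^ j) ≈ 0#
      term n c with toℕ n ≤? toℕ m
      ... | yes n≤m = trans (*-congʳ (X≈0 n c n≤m)) (zeroˡ _)
      ... | no _ = trans (*-congˡ (0^q^j≈0 j)) (zeroʳ _)

    ⋆twist-E-other-column : ∀ (X : Mat) j x (m : Fin r) b → ¬ (toℕ b ≡ 0) → (X ⋆ twist q j (Emat u)) x (m , b) ≈ 0#
    ⋆twist-E-other-column X j x m b b≢0 = ∑Idx-zero term
      where
      term : ∀ n c → X x (n , c) * pow (Emat u (n , c) (m , b)) (q ^ j) ≈ 0#
      term n c with toℕ n ≤? toℕ m | toℕ c ≟ dd s (toℕ n) ∸ 1 | toℕ b ≟ 0
      ... | yes _ | yes _ | yes b≡0 = ⊥-elim (b≢0 b≡0)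
      ... | yes _ | yes _ | no _ = trans (*-congˡ (0^q^j≈0 j)) (zeroʳ _)
      ... | yes _ | no _ | _ = trans (*-congˡ (0^q^j≈0 j)) (zeroʳ _)
      ... | no _ | _ | _ = trans (*-congˡ (0^q^j≈0 j)) (zeroʳ _)

    first-column-E : Mat → ℕ → Idx s → Fin r → Carrier
    first-column-E X j x m =
      ∑Fin r (λ n → if ⌊ toℕ n ≤? toℕ m ⌋ then X x (n , last n) * pow (Ecoef u (toℕ n) (toℕ m)) (q ^ j) else 0#)

    ⋆twist-E-first-column : ∀ (X : Mat) j x (m : Fin r) b → toℕ b ≡ 0 →
      (X ⋆ twist q j (Emat u)) x (m , b) ≈ first-column-E X j x m
    ⋆twist-E-first-column X j x m b b≡0 = ∑Fin-cong r block
      where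
      block : ∀ n → ∑Fin (dd s (toℕ n)) (λ c → X x (n , c) * pow (Emat u (n , c) (m , b)) (q ^ j))
                ≈ (if ⌊ toℕ n ≤? toℕ m ⌋ then X x (n , last n) * pow (Ecoef u (toℕ n) (toℕ m)) (q ^ j) else 0#)
      block n with toℕ n ≤? toℕ m
      ... | no _ = ∑Fin-zero (dd s (toℕ n)) (λ c → trans (*-congˡ (0^q^j≈0 j)) (zeroʳ _))
      ... | yes _ = trans
        (∑Fin-δ (dd s (toℕ n)) (last n) (λ c c≢last →
          trans (*-congˡ (trans (pow-cong (q ^ j) (if-false (Eq.cong (_∧ ⌊ toℕ b ≟ 0 ⌋)
                   (≟-false (λ e → c≢last (Eq.trans e (Eq.sym (toℕ-last n)))))))) (0^q^j≈0 j))) (zeroʳ _)))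
        (*-congˡ (pow-cong (q ^ j) (if-true (Eq.cong₂ _∧_ (≟-true (toℕ-last n)) (≟-true b≡0)))))

    -- The factor u_w^{q^v} / L_v^{s_w} contributed by an index i_w = v of the
    -- closed formula, and its version for the positions w = ℓ, ℓ+1, ….
    weight : ℕ → ℕ → Carrier
    weight w v = pow (ext u 1# w) (q ^ v) * (pow (Lfac q θ v) (ext s 0 w)) ⁻¹

    weightFrom : ℕ → ℕ → ℕ → Carrier
    weightFrom l w v = weight (l +ℕ w) v

    closedForm : ℕ → ℕ → ℕ → Carrier
    closedForm l i k = pow (- 1#) (k ∸ l) * (NondecSum (weightFrom l) (k ∸ l) i 0 * (pow (Lfac q θ i) (dd s k)) ⁻¹)

    Lpow≉0 : ∀ v n → pow (Lfac q θ v) n ≉0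
    Lpow≉0 v n = pow-≉0 n (L≉0 v)

    nondecFrom-0 : ∀ {i} K (f : Fin K → Fin i) → nondecFrom K 0 f ≡ nondec f
    nondecFrom-0 zero f = Eq.refl
    nondecFrom-0 (suc K) f = Eq.refl

    Ysum-term : ∀ l i K (LD : Carrier) → LD ≉0 → (f : Fin K → Fin i) →
      (if nondec f then ∏Fin K (λ j → pow (ext u 1# (l +ℕ toℕ j)) (q ^ toℕ (f j)))
           * ((∏Fin K (λ j → pow (Lfac q θ (toℕ (f j))) (ext s 0 (l +ℕ toℕ j))) * LD) ⁻¹)
       else 0#)
      ≈ (if nondecFrom K 0 f then ∏Fin K (λ j → weightFrom l (toℕ j) (toℕ (f j))) else 0#) * LD ⁻¹
    Ysum-term l i K LD LD≉0 f rewrite nondecFrom-0 K f with nondec f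
    ... | false = sym (zeroˡ _)
    ... | true = begin
      U * ((V * LD) ⁻¹)                  ≈⟨ *-congˡ (⁻¹-distrib-* V≉0 LD≉0) ⟩
      U * (V ⁻¹ * LD ⁻¹)                 ≈⟨ sym (*-assoc _ _ _) ⟩
      (U * V ⁻¹) * LD ⁻¹                 ≈⟨ *-congʳ (*-congˡ (∏Fin-⁻¹ K _ (λ j → Lpow≉0 (toℕ (f j)) (ext s 0 (l +ℕ toℕ j))))) ⟩
      (U * ∏Fin K (λ j → (pow (Lfac q θ (toℕ (f j))) (ext s 0 (l +ℕ toℕ j))) ⁻¹)) * LD ⁻¹
                                         ≈⟨ *-congʳ (sym (∏Fin-* K _ _)) ⟩
      ∏Fin K (λ j → weightFrom l (toℕ j) (toℕ (f j))) * LD ⁻¹ ∎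
      where
      U V : Carrier
      U = ∏Fin K (λ j → pow (ext u 1# (l +ℕ toℕ j)) (q ^ toℕ (f j)))
      V = ∏Fin K (λ j → pow (Lfac q θ (toℕ (f j))) (ext s 0 (l +ℕ toℕ j)))
      V≉0 : V ≉0
      V≉0 = ∏Fin-≉0 K _ (λ j → Lpow≉0 (toℕ (f j)) (ext s 0 (l +ℕ toℕ j)))

    Ysum≈closedForm : ∀ l m i → pow (- 1#) (m ∸ l) * Ysum q θ u l m i ≈ closedForm l i m
    Ysum≈closedForm l m i = *-congˡ (begin
      Ysum q θ u l m i
        ≈⟨ ∑Fun-cong (m ∸ l) i (Ysum-term l i (m ∸ l) LD (Lpow≉0 i (dd s m))) ⟩
      ∑Fun (m ∸ l) i (λ f → (if nondecFrom (m ∸ l) 0 f then ∏Fin (m ∸ l) (λ j → weightFrom l (toℕ j) (toℕ (f j))) else 0#) * LD ⁻¹)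
        ≈⟨ sym (∑Fun-*ʳ (m ∸ l) i _ _) ⟩
      ∑Fun (m ∸ l) i (λ f → if nondecFrom (m ∸ l) 0 f then ∏Fin (m ∸ l) (λ j → weightFrom l (toℕ j) (toℕ (f j))) else 0#) * LD ⁻¹
        ≈⟨ *-congʳ (nondecSum-∑Fun (weightFrom l) (m ∸ l) i 0) ⟩
      NondecSum (weightFrom l) (m ∸ l) i 0 * LD ⁻¹ ∎)
      where
      LD : Carrier
      LD = pow (Lfac q θ i) (dd s m)

    -- (E_{ab})^{q^j} = (−1)^{b−a} (u_a ⋯ u_{b−1})^{q^j}, as q^j is odd or −1 = 1.
    Ecoef-twist : ∀ a b j → pow (Ecoef u a b) (q ^ j) ≈ pow (- 1#) (b ∸ a) * pow (∏Range a b (ext u 1#)) (q ^ j)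
    Ecoef-twist a b j =
      trans (pow-distrib-* _ _ (q ^ j)) (*-congʳ (trans (pow-comm (- 1#) (b ∸ a) (q ^ j)) (pow-cong (b ∸ a) (−1^q^j j))))

    d-split : ∀ a b → a ≤ b → b ≤ r → dd s a ≡ sumRangeℕ a b (ext s 0) +ℕ dd s b
    d-split a b a≤b b≤r =
      Eq.trans (sumRange-count a r s')
      (Eq.trans (Eq.cong (λ n → sumFrom n a s') r∸a)
      (Eq.trans (sumFrom-+ (b ∸ a) (r ∸ b) a s')
                (Eq.cong₂ _+ℕ_ (Eq.sym (sumRange-count a b s'))
                               (Eq.trans (Eq.cong (λ z → sumFrom (r ∸ b) z s') (NP.m+[n∸m]≡n a≤b))
                                         (Eq.sym (sumRange-count b r s'))))))
      where
      s' : ℕ → ℕ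
      s' = ext s 0
      r∸a : r ∸ a ≡ (b ∸ a) +ℕ (r ∸ b)
      r∸a = Eq.trans (Eq.cong (_∸ a) (Eq.sym (NP.m+[n∸m]≡n b≤r))) (NP.+-∸-comm (r ∸ b) a≤b)

    weight-∏Range : ∀ a b j →
      ∏Range a b (λ w → weight w j) ≈ pow (∏Range a b (ext u 1#)) (q ^ j) * (pow (Lfac q θ j) (sumRangeℕ a b (ext s 0))) ⁻¹
    weight-∏Range a b j rewrite ∏Range-count a b (λ w → weight w j) | ∏Range-count a b (ext u 1#)
                              | sumRange-count a b (ext s 0) = begin
      ∏From n a (λ w → pow (ext u 1# w) Q * (pow Lj (ext s 0 w)) ⁻¹)
        ≈⟨ ∏From-* n a _ _ ⟩
      ∏From n a (λ w → pow (ext u 1# w) Q) * ∏From n a (λ w → (pow Lj (ext s 0 w)) ⁻¹)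
        ≈⟨ *-cong (sym (∏From-pow n a (ext u 1#) Q)) (sym (∏From-⁻¹ n a _ (λ w → Lpow≉0 j (ext s 0 w)))) ⟩
      pow (∏From n a (ext u 1#)) Q * (∏From n a (λ w → pow Lj (ext s 0 w))) ⁻¹
        ≈⟨ *-congˡ (⁻¹-cong (∏From-≉0 n a _ (λ w _ → Lpow≉0 j (ext s 0 w))) (sym (pow-sumFrom Lj n a (ext s 0)))) ⟩
      pow (∏From n a (ext u 1#)) Q * (pow Lj (sumFrom n a (ext s 0))) ⁻¹ ∎
      where
      n Q : ℕ
      n = b ∸ a
      Q = q ^ j
      Lj : Carrier
      Lj = Lfac q θ j

    -- One term of the recursion: the sequences whose last K − t entries equal
    -- j contribute y_j[ℓ, ℓ+t] · (E_{ℓ+t, ℓ+K})^{q^j}.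
    closedForm-term : ∀ l K j t → t ≤ K → l +ℕ K ≤ r →
      pow (- 1#) K * ((NondecSum (weightFrom l) t j 0 * ∏Range t K (λ w → weightFrom l w j)) * (pow (Lfac q θ j) (dd s (l +ℕ K))) ⁻¹)
      ≈ closedForm l j (l +ℕ t) * pow (Ecoef u (l +ℕ t) (l +ℕ K)) (q ^ j)
    closedForm-term l K j t t≤K l+K≤r = begin
      pow (- 1#) K * ((N * Π) * Lb⁻)            ≈⟨ *-cong sign-split (*-congʳ (*-congˡ weights)) ⟩
      (σt * σ) * ((N * (U * Lab⁻)) * Lb⁻)       ≈⟨ solve 6 (λ σt σ N U Lab Lb → (σt :* σ) :* ((N :* (U :* Lab)) :* Lb)
                                                                := (σt :* (N :* (Lab :* Lb))) :* (σ :* U)) refl σt σ N U Lab⁻ Lb⁻ ⟩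
      (σt * (N * (Lab⁻ * Lb⁻))) * (σ * U)       ≈⟨ *-cong (*-congˡ (*-congˡ (sym La⁻))) (sym (Ecoef-twist a b j)) ⟩
      (σt * (N * (pow Lj (dd s a)) ⁻¹)) * pow (Ecoef u a b) (q ^ j)
        ≡⟨ Eq.cong (λ z → (pow (- 1#) z * (NondecSum (weightFrom l) z j 0 * (pow Lj (dd s a)) ⁻¹)) * pow (Ecoef u a b) (q ^ j))
                   (Eq.sym (NP.m+n∸m≡n l t)) ⟩
      closedForm l j a * pow (Ecoef u a b) (q ^ j) ∎
      where
      a b Sab : ℕ
      a = l +ℕ t
      b = l +ℕ K
      Sab = sumRangeℕ a b (ext s 0)
      Lj N Π U Lab⁻ Lb⁻ σt σ : Carrier
      Lj = Lfac q θ j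
      N = NondecSum (weightFrom l) t j 0
      Π = ∏Range t K (λ w → weightFrom l w j)
      U = pow (∏Range a b (ext u 1#)) (q ^ j)
      Lab⁻ = (pow Lj (sumRangeℕ a b (ext s 0))) ⁻¹
      Lb⁻ = (pow Lj (dd s b)) ⁻¹
      σt = pow (- 1#) t
      σ = pow (- 1#) (b ∸ a)
      sign-split : pow (- 1#) K ≈ σt * σ
      sign-split = trans (reflexive (Eq.cong (pow (- 1#)) (Eq.trans (Eq.sym (NP.m+[n∸m]≡n t≤K)) (Eq.cong (t +ℕ_) (Eq.sym (NP.[m+n]∸[m+o]≡n∸o l K t))))))
                         (pow-+ (- 1#) t (b ∸ a))
      weights : Π ≈ U * Lab⁻
      weights = trans (reflexive (Eq.sym (∏Range-shift l t K (λ w → weight w j)))) (weight-∏Range a b j)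
      La⁻ : (pow Lj (dd s a)) ⁻¹ ≈ Lab⁻ * Lb⁻
      La⁻ = begin
        (pow Lj (dd s a)) ⁻¹                              ≡⟨ Eq.cong (λ z → (pow Lj z) ⁻¹) (d-split a b (NP.+-monoʳ-≤ l t≤K) l+K≤r) ⟩
        (pow Lj (sumRangeℕ a b (ext s 0) +ℕ dd s b)) ⁻¹   ≈⟨ ⁻¹-cong (Lpow≉0 j (Sab +ℕ dd s b)) (pow-+ Lj Sab (dd s b)) ⟩
        (pow Lj (sumRangeℕ a b (ext s 0)) * pow Lj (dd s b)) ⁻¹ ≈⟨ ⁻¹-distrib-* (Lpow≉0 j Sab) (Lpow≉0 j (dd s b)) ⟩
        Lab⁻ * Lb⁻                                        ∎

    closedForm-recursion : ∀ l M j → l ≤ M → M < r →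
      closedForm l (suc j) M * pow (cθ (suc j)) (dd s M)
        ≈ sumℕ (suc (M ∸ l)) (λ t → closedForm l j (l +ℕ t) * pow (Ecoef u (l +ℕ t) M) (q ^ j))
    closedForm-recursion l M j l≤M M<r with M ∸ l | NP.m+[n∸m]≡n l≤M
    ... | K | Eq.refl = begin
      (σ * (N * (pow (Lfac q θ (suc j)) D) ⁻¹)) * cD  ≈⟨ *-congʳ (*-congˡ (*-congˡ L⁻-suc)) ⟩
      (σ * (N * (Lb⁻ * cD ⁻¹))) * cD                  ≈⟨ solve 5 (λ σ N Lb ci c → (σ :* (N :* (Lb :* ci))) :* c := (σ :* (N :* Lb)) :* (ci :* c))
                                                              refl σ N Lb⁻ (cD ⁻¹) cD ⟩
      (σ * (N * Lb⁻)) * (cD ⁻¹ * cD)                  ≈⟨ trans (*-congˡ (⁻¹-inverseˡ cD≉0)) (*-identityʳ _) ⟩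
      σ * (N * Lb⁻)                                   ≈⟨ *-congˡ (*-congʳ (nondecSum-split (weightFrom l) K j 0 z≤n)) ⟩
      σ * (sumℕ (suc K) T * Lb⁻)                      ≈⟨ *-congˡ (sumℕ-*ʳ (suc K) Lb⁻ T) ⟩
      σ * sumℕ (suc K) (λ t → T t * Lb⁻)              ≈⟨ sumℕ-*ˡ (suc K) σ _ ⟩
      sumℕ (suc K) (λ t → σ * (T t * Lb⁻))            ≈⟨ sumℕ-cong (suc K) (λ t t≤K → closedForm-term l K j t (NP.<⇒≤pred t≤K) (NP.<⇒≤ M<r)) ⟩
      sumℕ (suc K) (λ t → closedForm l j (l +ℕ t) * pow (Ecoef u (l +ℕ t) (l +ℕ K)) (q ^ j)) ∎
      where
      D : ℕ
      D = dd s (l +ℕ K)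
      σ N Lb⁻ cD : Carrier
      σ = pow (- 1#) K
      N = NondecSum (weightFrom l) K (suc j) 0
      Lb⁻ = (pow (Lfac q θ j) D) ⁻¹
      cD = pow (cθ (suc j)) D
      T : ℕ → Carrier
      T t = NondecSum (weightFrom l) t j 0 * ∏Range t K (λ w → weightFrom l w j)
      cD≉0 : cD ≉0
      cD≉0 = pow-≉0 D (cθ≉0 (suc j) (s≤s z≤n))
      L⁻-suc : (pow (Lfac q θ (suc j)) D) ⁻¹ ≈ Lb⁻ * cD ⁻¹
      L⁻-suc = trans (⁻¹-cong (Lpow≉0 (suc j) D) (trans (pow-cong D (L-suc j)) (pow-distrib-* _ _ D)))
                     (⁻¹-distrib-* (Lpow≉0 j D) cD≉0)

    closedForm-0-diagonal : ∀ l k → k ∸ l ≡ 0 → closedForm l 0 k ≈ 1#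
    closedForm-0-diagonal l k e with k ∸ l | e
    ... | .0 | Eq.refl = trans (*-identityˡ _) (trans (*-identityˡ _) (trans (⁻¹-cong (pow-≉0 (dd s k) 1≉0) (pow-1# (dd s k))) 1⁻¹≈1))

    closedForm-0-off-diagonal : ∀ l k K → k ∸ l ≡ suc K → closedForm l 0 k ≈ 0#
    closedForm-0-off-diagonal l k K e with k ∸ l | e
    ... | .(suc K) | Eq.refl = trans (*-congˡ (zeroˡ _)) (zeroʳ _)

    closedForm-diagonal : ∀ l i → closedForm l i l ≈ (pow (Lfac q θ i) (dd s l)) ⁻¹
    closedForm-diagonal l i with l ∸ l | NP.n∸n≡0 l
    ... | .0 | Eq.refl = trans (*-identityˡ _) (*-identityˡ _)

    module Logarithm (P : ℕ → Mat) (isLog : IsLogG q θ u P) where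

      -- The τ^{j+1}-coefficient of log_G ∘ ρ_t = ∂ρ_t ∘ log_G, at an entry where
      -- N P_{j+1} vanishes:  c_{j+1} P_{j+1} = P_{j+1} N + P_j E^{(q^j)}.
      coefficient-equation : ∀ j x y → ∑Idx (λ z → Nmat x z * P (suc j) z y) ≈ 0# →
        cθ (suc j) * P (suc j) x y ≈ ∑Idx (λ z → P (suc j) x z * Nmat z y) + (P j ⋆ twist q j (Emat u)) x y
      coefficient-equation j x y NP≈0 = isolate θ
        (trans (+-congʳ (sym (⋆twist-ρ0 (P (suc j)) (suc j) x y)))
          (trans (proj₂ isLog (suc j) x y) (ρ0⋆ (P (suc j)) x y)))
        NP≈0

      c≉0 : ∀ j → cθ (suc j) ≉0
      c≉0 j = cθ≉0 (suc j) (s≤s z≤n)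

      LowerTriangular : ℕ → Set ℓ'
      LowerTriangular i = ∀ (l m : Fin r) a b → toℕ m < toℕ l → P i (l , a) (m , b) ≈ 0#

      -- If P_j is block lower triangular, so is P_{j+1}: in a block (ℓ, m) with
      -- m < ℓ, induct on the column index b and on the number t of rows from
      -- row a to the bottom of the block; N P_{j+1} involves the row below,
      -- P_{j+1} N the column to the left, and P_j E^{(q^j)} only blocks n ≤ m.
      lower-triangular-step : ∀ j → LowerTriangular j → LowerTriangular (suc j)
      lower-triangular-step j Pj-lower l m a b m<l = entry (toℕ b) b Eq.refl (dd s (toℕ l) ∸ toℕ a) a
          (NP.m∸n+n≡m (NP.<⇒≤ (FP.toℕ<n a)))
        where
        entry : ∀ k (b : Fin (dd s (toℕ m))) → toℕ b ≡ k → ∀ t (a : Fin (dd s (toℕ l))) → t +ℕ toℕ a ≡ dd s (toℕ l) →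
          P (suc j) (l , a) (m , b) ≈ 0#
        entry k b b≡k t a t+a≡d = vanishes-by (c≉0 j) (coefficient-equation j (l , a) (m , b) (below t t+a≡d))
          (left k b≡k) (⋆twist-E-lower (P j) j (l , a) m b (λ n c n≤m → Pj-lower l n a c (NP.≤-<-trans n≤m m<l)))
          where
          below : ∀ t → t +ℕ toℕ a ≡ dd s (toℕ l) → ∑Idx (λ z → Nmat (l , a) z * P (suc j) z (m , b)) ≈ 0#
          below zero a≡d = ⊥-elim (NP.<-irrefl a≡d (FP.toℕ<n a))
          below (suc zero) 1+a≡d = N⋆-last-row (P (suc j)) l a (m , b) 1+a≡d
          below (suc (suc t)) t+a≡d = trans (N⋆-shift (P (suc j)) l a (m , b) a⁺ (FP.toℕ-fromℕ< a+1<d))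
                                            (entry k b b≡k (suc t) a⁺ t+a⁺≡d)
            where
            a+1<d : suc (toℕ a) < dd s (toℕ l)
            a+1<d = Eq.subst (suc (toℕ a) <_) t+a≡d (s≤s (s≤s (NP.m≤n+m (toℕ a) t)))
            a⁺ : Fin (dd s (toℕ l))
            a⁺ = fromℕ< a+1<d
            t+a⁺≡d : suc t +ℕ toℕ a⁺ ≡ dd s (toℕ l)
            t+a⁺≡d = Eq.trans (Eq.cong (suc t +ℕ_) (FP.toℕ-fromℕ< a+1<d)) (Eq.trans (Eq.cong suc (NP.+-suc t (toℕ a))) t+a≡d)
          left : ∀ k → toℕ b ≡ k → ∑Idx (λ z → P (suc j) (l , a) z * Nmat z (m , b)) ≈ 0#
          left zero b≡0 = ⋆N-first-column (P (suc j)) (l , a) m b b≡0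
          left (suc k) b≡1+k = trans (⋆N-shift (P (suc j)) (l , a) m b b⁻ (Eq.trans b≡1+k (Eq.cong suc (Eq.sym (FP.toℕ-fromℕ< k<d)))))
                                     (entry k b⁻ (FP.toℕ-fromℕ< k<d) t a t+a≡d)
            where
            k<d : k < dd s (toℕ m)
            k<d = NP.<-trans (NP.n<1+n k) (Eq.subst (_< dd s (toℕ m)) b≡1+k (FP.toℕ<n b))
            b⁻ : Fin (dd s (toℕ m))
            b⁻ = fromℕ< k<d

      lower-triangular : ∀ i → LowerTriangular i
      lower-triangular zero l m a b m<l =
        trans (proj₁ isLog (l , a) (m , b)) (if-false (Eq.cong (_∧ ⌊ toℕ a ≟ toℕ b ⌋) (≟-false (λ e → NP.<-irrefl (Eq.sym e) m<l))))
      lower-triangular (suc j) = lower-triangular-step j (lower-triangular j)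

      module LastRow (l : Fin r) where
        lℕ : ℕ
        lℕ = toℕ l

        x : Idx s
        x = (l , last l)

        -- N P_{j+1} vanishes on a last row, so the coefficient equation holds at every entry.
        last-row-equation : ∀ j y →
          cθ (suc j) * P (suc j) x y ≈ ∑Idx (λ z → P (suc j) x z * Nmat z y) + (P j ⋆ twist q j (Emat u)) x y
        last-row-equation j y = coefficient-equation j x y (N⋆-last-row (P (suc j)) l (last l) y (suc-toℕ-last l))

        -- Scanning block m from its first column: c^{k+1} P_{j+1}[x, (m, k)] equals the
        -- first-column entry of P_j E^{(q^j)}, the only nonzero entry of that block row.
        column-scan : ∀ j (m : Fin r) k (b : Fin (dd s (toℕ m))) → toℕ b ≡ k →
          pow (cθ (suc j)) (suc k) * P (suc j) x (m , b) ≈ first-column-E (P j) j x m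
        column-scan j m zero b b≡0 = begin
          (cj * 1#) * P (suc j) x (m , b)                                          ≈⟨ *-congʳ (*-identityʳ _) ⟩
          cj * P (suc j) x (m , b)                                                 ≈⟨ last-row-equation j (m , b) ⟩
          ∑Idx (λ z → P (suc j) x z * Nmat z (m , b)) + (P j ⋆ twist q j (Emat u)) x (m , b)
                  ≈⟨ +-cong (⋆N-first-column (P (suc j)) x m b b≡0) (⋆twist-E-first-column (P j) j x m b b≡0) ⟩
          0# + first-column-E (P j) j x m                                         ≈⟨ +-identityˡ _ ⟩
          first-column-E (P j) j x m                                              ∎
          where
          cj : Carrier
          cj = cθ (suc j)
        column-scan j m (suc k) b b≡1+k = begin
          (cj * pow cj (suc k)) * P (suc j) x (m , b)        ≈⟨ *-congʳ (*-comm _ _) ⟩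
          (pow cj (suc k) * cj) * P (suc j) x (m , b)        ≈⟨ *-assoc _ _ _ ⟩
          pow cj (suc k) * (cj * P (suc j) x (m , b))        ≈⟨ *-congˡ (last-row-equation j (m , b)) ⟩
          pow cj (suc k) * (∑Idx (λ z → P (suc j) x z * Nmat z (m , b)) + (P j ⋆ twist q j (Emat u)) x (m , b))
              ≈⟨ *-congˡ (+-cong (⋆N-shift (P (suc j)) x m b b⁻ (Eq.trans b≡1+k (Eq.cong suc (Eq.sym (FP.toℕ-fromℕ< k<d)))))
                                  (⋆twist-E-other-column (P j) j x m b (λ b≡0 → NP.0≢1+n (Eq.trans (Eq.sym b≡0) b≡1+k)))) ⟩
          pow cj (suc k) * (P (suc j) x (m , b⁻) + 0#)       ≈⟨ *-congˡ (+-identityʳ _) ⟩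
          pow cj (suc k) * P (suc j) x (m , b⁻)              ≈⟨ column-scan j m k b⁻ (FP.toℕ-fromℕ< k<d) ⟩
          first-column-E (P j) j x m                        ∎
          where
          cj : Carrier
          cj = cθ (suc j)
          k<d : k < dd s (toℕ m)
          k<d = NP.<-trans (NP.n<1+n k) (Eq.subst (_< dd s (toℕ m)) b≡1+k (FP.toℕ<n b))
          b⁻ : Fin (dd s (toℕ m))
          b⁻ = fromℕ< k<d

        last-column : ∀ j (m : Fin r) → pow (cθ (suc j)) (dd s (toℕ m)) * P (suc j) x (m , last m) ≈ first-column-E (P j) j x m
        last-column j m = trans (reflexive (Eq.cong (λ n → pow (cθ (suc j)) n * P (suc j) x (m , last m)) (Eq.sym (suc-toℕ-last m))))
                                (column-scan j m (toℕ (last m)) (last m) Eq.refl)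

        -- Given the closed form for the last-row corners of P_j, the first-column
        -- entry of P_j E^{(q^j)} in block m is the right side of closedForm-recursion;
        -- blocks n < ℓ do not contribute since P_j is block lower triangular.
        first-column-closedForm : ∀ j (m : Fin r) → lℕ ≤ toℕ m →
          (∀ (n : Fin r) → lℕ ≤ toℕ n → P j x (n , last n) ≈ closedForm lℕ j (toℕ n)) →
          first-column-E (P j) j x m ≈ sumℕ (suc (toℕ m ∸ lℕ)) (λ t → closedForm lℕ j (lℕ +ℕ t) * pow (Ecoef u (lℕ +ℕ t) (toℕ m)) (q ^ j))
        first-column-closedForm j m l≤m corners = trans (∑Fin-cong r term) (sum-between r lℕ (toℕ m) F l≤m (FP.toℕ<n m))
          where
          F : ℕ → Carrier
          F n = closedForm lℕ j n * pow (Ecoef u n (toℕ m)) (q ^ j)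
          term : ∀ n → (if ⌊ toℕ n ≤? toℕ m ⌋ then P j x (n , last n) * pow (Ecoef u (toℕ n) (toℕ m)) (q ^ j) else 0#)
                       ≈ (if toℕ n ≤ᵇ toℕ m then (if lℕ ≤ᵇ toℕ n then F (toℕ n) else 0#) else 0#)
          term n with toℕ n ≤? toℕ m
          ... | no n≰m = sym (if-false (≤ᵇ-false (NP.≰⇒> n≰m)))
          ... | yes n≤m = trans in-range (sym (if-true (≤ᵇ-true n≤m)))
            where
            in-range : P j x (n , last n) * pow (Ecoef u (toℕ n) (toℕ m)) (q ^ j) ≈ (if lℕ ≤ᵇ toℕ n then F (toℕ n) else 0#)
            in-range with lℕ ≤? toℕ n
            ... | yes l≤n = trans (*-congʳ (corners n l≤n)) (sym (if-true (≤ᵇ-true l≤n)))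
            ... | no l≰n = trans (trans (*-congʳ (lower-triangular j l n (last l) (last n) (NP.≰⇒> l≰n))) (zeroˡ _))
                                 (sym (if-false (≤ᵇ-false (NP.≰⇒> l≰n))))

        -- The last-row corners y_i[ℓ m] (m ≥ ℓ) are given by the closed form: both
        -- agree for i = 0 and satisfy the same recursion in i.
        last-row : ∀ i (m : Fin r) → lℕ ≤ toℕ m → P i x (m , last m) ≈ closedForm lℕ i (toℕ m)
        last-row zero m l≤m with lℕ ≟ toℕ m
        ... | yes l≡m = trans (proj₁ isLog x (m , last m))
          (trans (if-true (Eq.cong₂ _∧_ (≟-true l≡m) (≟-true (Eq.trans (toℕ-last l) (Eq.trans (Eq.cong (λ z → dd s z ∸ 1) l≡m) (Eq.sym (toℕ-last m)))))))
                 (sym (closedForm-0-diagonal lℕ (toℕ m) (Eq.trans (Eq.cong (toℕ m ∸_) l≡m) (NP.n∸n≡0 (toℕ m))))))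
        ... | no l≢m = trans (proj₁ isLog x (m , last m))
          (trans (if-false (Eq.cong (_∧ ⌊ toℕ (last l) ≟ toℕ (last m) ⌋) (≟-false l≢m)))
                 (sym (closedForm-0-off-diagonal lℕ (toℕ m) _ (∸-suc (NP.≤∧≢⇒< l≤m l≢m)))))
        last-row (suc j) m l≤m = cancelˡ (pow-≉0 (dd s (toℕ m)) (c≉0 j)) (begin
          pow (cθ (suc j)) (dd s (toℕ m)) * P (suc j) x (m , last m)        ≈⟨ last-column j m ⟩
          first-column-E (P j) j x m                                        ≈⟨ first-column-closedForm j m l≤m (λ n → last-row j n) ⟩
          sumℕ (suc (toℕ m ∸ lℕ)) (λ t → closedForm lℕ j (lℕ +ℕ t) * pow (Ecoef u (lℕ +ℕ t) (toℕ m)) (q ^ j))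
                                                                            ≈⟨ sym (closedForm-recursion lℕ (toℕ m) j l≤m (FP.toℕ<n m)) ⟩
          closedForm lℕ (suc j) (toℕ m) * pow (cθ (suc j)) (dd s (toℕ m))   ≈⟨ *-comm _ _ ⟩
          pow (cθ (suc j)) (dd s (toℕ m)) * closedForm lℕ (suc j) (toℕ m)   ∎)

        corner : ∀ i (m : Fin r) a b → lℕ ≤ toℕ m → toℕ a ≡ dd s lℕ ∸ 1 → toℕ b ≡ dd s (toℕ m) ∸ 1 →
          P i (l , a) (m , b) ≈ closedForm lℕ i (toℕ m)
        corner i m a b l≤m a-last b-last rewrite toℕ≡d-1⇒last l a a-last | toℕ≡d-1⇒last m b b-last = last-row i m l≤m

mainTheorem3 : {c ℓ' : Level} (K : Field c ℓ') →
  let open Field K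
      open FieldOps K
  in (p e q : ℕ) → Prime p → 1 ≤ e → q ≡ p ^ e →
     ofℕ p ≈ 0# → AlgClosed →
     (θ : Carrier) → Transcendental q θ → AlgebraicOverk q θ →
     (r : ℕ) (s : Fin r → ℕ) → (∀ l → 1 ≤ s l) →
     (u : Fin r → Carrier) → (∀ l → ¬ (u l ≈ 0#)) →
     let open Blocks s
     in (P : ℕ → Mat) → IsLogG q θ u P →
        (∀ i (l m : Fin r) a b → toℕ m < toℕ l → P i (l , a) (m , b) ≈ 0#) ×
        (∀ i (l : Fin r) a b →
           toℕ a ≡ dd s (toℕ l) ∸ 1 → toℕ b ≡ dd s (toℕ l) ∸ 1 →
           P i (l , a) (l , b) ≈ (pow (Lfac q θ i) (dd s (toℕ l))) ⁻¹) ×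
        (∀ i (l m : Fin r) a b → toℕ l < toℕ m →
           toℕ a ≡ dd s (toℕ l) ∸ 1 → toℕ b ≡ dd s (toℕ m) ∸ 1 →
           P i (l , a) (m , b) ≈
             pow (- 1#) (toℕ m ∸ toℕ l) * Ysum q θ u (toℕ l) (toℕ m) i)
mainTheorem3 K p e q p-prime e≥1 q≡p^e char-p _ θ transcendental _ r s s≥1 u _ P isLog =
    lower-triangular
  , (λ i l a b a-last b-last →
       trans (corner l i l a b NP.≤-refl a-last b-last) (closedForm-diagonal (toℕ l) i))
  , (λ i l m a b l<m a-last b-last →
       trans (corner l i m a b (NP.<⇒≤ l<m) a-last b-last) (sym (Ysum≈closedForm (toℕ l) (toℕ m) i)))
  where
  open Field K using (trans; sym)
  open Development K
  open Matrices q θ (prime-power≥2 p-prime e≥1 q≡p^e) (−1^q^j≈−1 {e = e} p-prime q≡p^e char-p) transcendental r s s≥1 u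
  open Logarithm P isLog
  open LastRow
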